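{- Let $a,b,c$ be nonnegative integers with $a+b\ge 1$ and $b+c\ge 1$. Then \[ P(GS_{a,b,c},1)=\frac{b}{(b+c+1)(b+c)}+\frac{b}{(a+b+1)(a+b)}, \] and for all nonnegative integers $a,b,c$, \[ P(GS_{a,b,c}^{+},1)=\frac{2b+c+2}{(b+c+1)(b+c+2)}+\frac{2b+a+2}{(b+a+1)(b+a+2)}-\frac{1}{a+2b+c+1}. \]
   Context: Forest building process: given a finite graph $G$ and a linear ordering of its edges, go through the edges in order and keep an edge if and only if at least one of its endpoints is not an endpoint of any earlier edge in the ordering (earlier edges count whether or not they were kept). The kept edges form a forest spanning the non-isolated vertices of $G$. $P(G,k)$ denotes the probability that, for a uniformly random ordering of the edges of $G$, the resulting forest has exactly $k$ trees (connected components). The glued-star graph $GS_{a,b,c}$ has two center vertices $u,w$, $a$ vertices adjacent only to $u$, $b$ vertices adjacent to both $u$ and $w$, and $c$ vertices adjacent only to $w$ (i.e., the stars $K_{1,a+b}$ and $K_{1,b+c}$ with $b$ of their leaves identified); it has $a+2b+c$ edges. $GS_{a,b,c}^{+}$ is $GS_{a,b,c}$ with the additional edge $uw$ joining the two centers. -}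

module Defs where

open import Data.Bool using (Bool; true; false; not; _∨_; if_then_else_)
open import Data.Nat using (ℕ; zero; suc; _+_; _≡ᵇ_)
open import Data.List using (List; []; _∷_; map; concat; concatMap; length; filterᵇ; deduplicateᵇ)
open import Data.Bool.ListAction using (any)
open import Data.Product using (_×_; _,_)
open import Data.Integer using (+_)
open import Data.Rational using (ℚ; _/_; 0ℚ)

-- Graphs: vertices are natural numbers, a graph is given by its list of
-- (distinct) edges, each edge an (unordered) pair of distinct vertices.
Edge : Set
Edge = ℕ × ℕ

Graph : Set
Graph = List Edge

_∈ᵇ_ : ℕ → List ℕ → Bool
x ∈ᵇ xs = any (x ≡ᵇ_) xs

insertions : {A : Set} → A → List A → List (List A)
insertions x [] = (x ∷ []) ∷ []
insertions x (y ∷ ys) = (x ∷ y ∷ ys) ∷ map (y ∷_) (insertions x ys)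

orderings : {A : Set} → List A → List (List A)
orderings [] = [] ∷ []
orderings (x ∷ xs) = concatMap (insertions x) (orderings xs)

-- Forest building process: go through the edges in order, keep an edge iff
-- at least one endpoint is not an endpoint of an earlier edge (kept or not).
buildFrom : List ℕ → List Edge → List Edge
buildFrom seen [] = []
buildFrom seen ((u , v) ∷ es) =
  if not (u ∈ᵇ seen) ∨ not (v ∈ᵇ seen)
  then (u , v) ∷ buildFrom (u ∷ v ∷ seen) es
  else buildFrom (u ∷ v ∷ seen) es

forest : List Edge → List Edge
forest = buildFrom []

-- Non-isolated vertices of a graph (endpoints of edges, without repetition).
vertices : Graph → List ℕ
vertices G = deduplicateᵇ _≡ᵇ_ (concatMap (λ { (u , v) → u ∷ v ∷ [] }) G)

addEdge : Edge → List (List ℕ) → List (List ℕ)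
addEdge (u , v) blocks =
  concat (filterᵇ meets blocks) ∷ filterᵇ (λ B → not (meets B)) blocks
  where
  meets : List ℕ → Bool
  meets B = (u ∈ᵇ B) ∨ (v ∈ᵇ B)

componentsFrom : List (List ℕ) → List Edge → List (List ℕ)
componentsFrom blocks [] = blocks
componentsFrom blocks (e ∷ es) = componentsFrom (addEdge e blocks) es

numComponents : List ℕ → List Edge → ℕ
numComponents V F = length (componentsFrom (map (λ x → x ∷ []) V) F)

numTrees : Graph → List Edge → ℕ
numTrees G σ = numComponents (vertices G) (forest σ)

-- n / d as a rational number, with the convention n / 0 = 0 (only ever
-- used with d ≠ 0 under the hypotheses of the statements).
frac : ℕ → ℕ → ℚ
frac n zero = 0ℚ
frac n (suc d) = (+ n) / suc d

-- P(G,k): probability, for a uniformly random ordering of the edges of G,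
-- that the resulting forest has exactly k trees.
P : Graph → ℕ → ℚ
P G k = frac (length (filterᵇ (λ σ → numTrees G σ ≡ᵇ k) (orderings G)))
             (length (orderings G))

-- Glued star GS_{a,b,c}: centres u = 0, w = 1; the a leaves of u are
-- 2 .. a+1, the b common neighbours are a+2 .. a+b+1, the c leaves of w
-- are a+b+2 .. a+b+c+1.
range : ℕ → ℕ → List ℕ
range s zero = []
range s (suc n) = s ∷ range (suc s) n

GS : ℕ → ℕ → ℕ → Graph
GS a b c =
  map (λ x → (0 , x)) (range 2 a)
  Data.List.++ concatMap (λ y → (0 , y) ∷ (1 , y) ∷ []) (range (2 + a) b)
  Data.List.++ map (λ z → (1 , z)) (range (2 + a + b) c)

GS⁺ : ℕ → ℕ → ℕ → Graph
GS⁺ a b c = (0 , 1) ∷ GS a b c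

module Submission where

-- Two general facts about
-- uniformly random orderings do the probabilistic work: sums over
-- orderings are invariant under permuting L, and the restriction principle
-- (the induced ordering of a sublist is uniform), from which
-- P(x first) = 1/n and P(x first, y second) = 1/(n(n-1)) on any sublist.
-- Next, for any loopless graph the number of trees of the forest is the
-- number of edges both of whose endpoints are new when reached.  For a
-- glued star, scanning an ordering from each centre z shows that the
-- forest is a single tree iff, for exactly one centre z, the first edge at
-- z is (z, y) for a middle vertex y whose other edge (z', y) came earlier
-- (for GS⁺ the edge uw first is the extra case).  Each such event has
-- probability 1/((k+1)k) among the k edges at z and (z', y), which gives
-- the formulas after summing over y and some fraction arithmetic.

module ListSums where

  open import Data.Bool using (Bool; true; false; not; _∨_; _∧_; if_then_else_)
  open import Data.Nat using (ℕ; suc; _+_; _*_)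
  open import Data.Nat.Properties using (+-assoc; *-zeroʳ; *-distribˡ-+; *-distribʳ-+)
  open import Data.Nat.ListAction using (sum)
  open import Data.Nat.ListAction.Properties using (sum-↭)
  open import Data.List using (List; []; _∷_; map; concatMap; length; filter; filterᵇ; _++_)
  open import Data.List.Relation.Binary.Permutation.Propositional using (_↭_)
  open import Data.List.Relation.Binary.Permutation.Propositional.Properties using () renaming (map⁺ to ↭-map⁺)
  open import Data.List.Relation.Unary.All as All using (All; []; _∷_)
  open import Data.Product using (_×_; _,_)
  open import Relation.Nullary.Decidable.Core using (does; Dec)
  open import Data.Bool.ListAction using (any)
  open import Function using (_∘_)
  open import Relation.Binary.PropositionalEquality using (_≡_; _≢_; refl; sym; trans; cong; cong₂)
  open import Data.Nat.Tactic.RingSolver using (solve-∀)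

  open Relation.Binary.PropositionalEquality.≡-Reasoning

  private variable A B : Set

  ⟦_⟧ : Bool → ℕ
  ⟦ true ⟧ = 1
  ⟦ false ⟧ = 0

  Σ[_] : List A → (A → ℕ) → ℕ
  Σ[ l ] f = sum (map f l)

  Σ-map : (l : List B) (f : A → ℕ) (g : B → A) → Σ[ map g l ] f ≡ Σ[ l ] (f ∘ g)
  Σ-map [] f g = refl
  Σ-map (x ∷ l) f g = cong (f (g x) +_) (Σ-map l f g)

  Σ-cong : (l : List A) {f g : A → ℕ} → (∀ a → f a ≡ g a) → Σ[ l ] f ≡ Σ[ l ] g
  Σ-cong [] e = refl
  Σ-cong (x ∷ l) e = cong₂ _+_ (e x) (Σ-cong l e)

  Σ-congAll : {l : List A} {f g : A → ℕ} → All (λ a → f a ≡ g a) l → Σ[ l ] f ≡ Σ[ l ] g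
  Σ-congAll [] = refl
  Σ-congAll (e ∷ es) = cong₂ _+_ e (Σ-congAll es)

  Σ-zero : (l : List A) {f : A → ℕ} → (∀ a → f a ≡ 0) → Σ[ l ] f ≡ 0
  Σ-zero [] h = refl
  Σ-zero (x ∷ l) h = cong₂ _+_ (h x) (Σ-zero l h)

  Σ-+ : (l : List A) (f g : A → ℕ) → Σ[ l ] (λ a → f a + g a) ≡ Σ[ l ] f + Σ[ l ] g
  Σ-+ [] f g = refl
  Σ-+ (x ∷ l) f g = begin
    f x + g x + Σ[ l ] (λ a → f a + g a) ≡⟨ cong (f x + g x +_) (Σ-+ l f g) ⟩
    f x + g x + (Σ[ l ] f + Σ[ l ] g)   ≡⟨ interchange (f x) (g x) (Σ[ l ] f) (Σ[ l ] g) ⟩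
    f x + Σ[ l ] f + (g x + Σ[ l ] g)   ∎
    where
    interchange : ∀ a b c d → a + b + (c + d) ≡ a + c + (b + d)
    interchange = solve-∀

  Σ-++ : (l m : List A) (f : A → ℕ) → Σ[ l ++ m ] f ≡ Σ[ l ] f + Σ[ m ] f
  Σ-++ [] m f = refl
  Σ-++ (x ∷ l) m f = trans (cong (f x +_) (Σ-++ l m f)) (sym (+-assoc (f x) _ _))

  Σ-concatMap : (h : B → List A) (l : List B) (f : A → ℕ) →
    Σ[ concatMap h l ] f ≡ Σ[ l ] (λ b → Σ[ h b ] f)
  Σ-concatMap h [] f = refl
  Σ-concatMap h (x ∷ l) f =
    trans (Σ-++ (h x) (concatMap h l) f) (cong (Σ[ h x ] f +_) (Σ-concatMap h l f))

  Σ-*ˡ : (l : List A) (k : ℕ) (f : A → ℕ) → Σ[ l ] (λ a → k * f a) ≡ k * Σ[ l ] f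
  Σ-*ˡ [] k f = sym (*-zeroʳ k)
  Σ-*ˡ (x ∷ l) k f = trans (cong (k * f x +_) (Σ-*ˡ l k f)) (sym (*-distribˡ-+ k (f x) _))

  Σ-*-const : (l : List A) (f : A → ℕ) (d m : ℕ) → All (λ a → f a * d ≡ m) l →
    Σ[ l ] f * d ≡ length l * m
  Σ-*-const [] f d m _ = refl
  Σ-*-const (a ∷ l) f d m (h ∷ hs) =
    trans (*-distribʳ-+ d (f a) (Σ[ l ] f)) (cong₂ _+_ h (Σ-*-const l f d m hs))

  Σ-swap : (l : List A) (m : List B) (F : B → A → ℕ) →
    Σ[ l ] (λ a → Σ[ m ] (λ b → F b a)) ≡ Σ[ m ] (λ b → Σ[ l ] (F b))
  Σ-swap l [] F = Σ-zero l (λ _ → refl)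
  Σ-swap l (b ∷ m) F =
    trans (Σ-+ l (F b) (λ a → Σ[ m ] (λ b → F b a))) (cong (Σ[ l ] (F b) +_) (Σ-swap l m F))

  Σ-↭ : {l m : List A} (f : A → ℕ) → l ↭ m → Σ[ l ] f ≡ Σ[ m ] f
  Σ-↭ f p = sum-↭ (↭-map⁺ f p)

  length-as-Σ : (l : List A) → length l ≡ Σ[ l ] (λ _ → 1)
  length-as-Σ [] = refl
  length-as-Σ (x ∷ l) = cong suc (length-as-Σ l)

  length-filter-as-Σ : (p : A → Bool) (l : List A) → length (filterᵇ p l) ≡ Σ[ l ] (λ a → ⟦ p a ⟧)
  length-filter-as-Σ p [] = refl
  length-filter-as-Σ p (x ∷ l) with p x
  ... | true = cong suc (length-filter-as-Σ p l)
  ... | false = length-filter-as-Σ p l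

  any-≢0 : (p : A → Bool) (L : List A) → Σ[ L ] (λ a → ⟦ p a ⟧) ≢ 0 → any p L ≡ true
  any-≢0 p [] nz with () ← nz refl
  any-≢0 p (a ∷ L) nz with p a
  ... | true = refl
  ... | false = any-≢0 p L nz

  filter-cons : (p : A → Bool) (x : A) (xs : List A) →
    filterᵇ p (x ∷ xs) ≡ (if p x then x ∷ filterᵇ p xs else filterᵇ p xs)
  filter-cons p x xs with p x
  ... | true = refl
  ... | false = refl

  filter-accept : (p : A → Bool) {x : A} (xs : List A) → p x ≡ true → filterᵇ p (x ∷ xs) ≡ x ∷ filterᵇ p xs
  filter-accept p xs e rewrite e = refl

  filter-reject : (p : A → Bool) {x : A} (xs : List A) → p x ≡ false → filterᵇ p (x ∷ xs) ≡ filterᵇ p xs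
  filter-reject p xs e rewrite e = refl

  filter-All : (p : A → Bool) (L : List A) → All (λ x → p x ≡ true) (filterᵇ p L)
  filter-All p [] = []
  filter-All p (x ∷ L) with p x in e
  ... | true = e ∷ filter-All p L
  ... | false = filter-All p L

  filter-id : (p : A → Bool) {L : List A} → All (λ x → p x ≡ true) L → filterᵇ p L ≡ L
  filter-id p [] = refl
  filter-id p {x ∷ L} (e ∷ es) = trans (filter-accept p L e) (cong (x ∷_) (filter-id p es))

  if-true : {X : Set} {b : Bool} {p q : X} → b ≡ true → (if b then p else q) ≡ p
  if-true refl = refl

  if-false : {X : Set} {b : Bool} {p q : X} → b ≡ false → (if b then p else q) ≡ q
  if-false refl = refl

  filter-ext : {A : Set} {P : A → Set} (P? : (x : A) → Dec (P x)) (q : A → Bool) →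
    (∀ x → does (P? x) ≡ q x) → (l : List A) → filter P? l ≡ filterᵇ q l
  filter-ext P? q h [] = refl
  filter-ext P? q h (x ∷ l) with does (P? x) in e
  ... | true = sym (trans (filter-accept q l (trans (sym (h x)) e)) (cong (x ∷_) (sym (filter-ext P? q h l))))
  ... | false = sym (trans (filter-reject q l (trans (sym (h x)) e)) (sym (filter-ext P? q h l)))

  filter-filter : {A : Set} (p q : A → Bool) (l : List A) → filterᵇ p (filterᵇ q l) ≡ filterᵇ (λ z → q z ∧ p z) l
  filter-filter p q [] = refl
  filter-filter p q (x ∷ l) with q x in eq
  ... | false = filter-filter p q l
  ... | true with p x in ep
  ...   | true = cong (x ∷_) (filter-filter p q l)
  ...   | false = filter-filter p q l

  filter-cong : {A : Set} (p q : A → Bool) → (∀ z → p z ≡ q z) → (l : List A) → filterᵇ p l ≡ filterᵇ q l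
  filter-cong p q h [] = refl
  filter-cong p q h (x ∷ l) rewrite filter-cons p x l | filter-cons q x l | h x with q x
  ... | true = cong (x ∷_) (filter-cong p q h l)
  ... | false = filter-cong p q h l

  length-filter-cons : {A : Set} (p : A → Bool) (x : A) (l : List A) → length (filterᵇ p (x ∷ l)) ≡ ⟦ p x ⟧ + length (filterᵇ p l)
  length-filter-cons p x l with p x
  ... | true = refl
  ... | false = refl

  filter-true : {A : Set} (l : List A) → filterᵇ (λ _ → true) l ≡ l
  filter-true [] = refl
  filter-true (x ∷ l) = cong (x ∷_) (filter-true l)

  Σ-filter-split : {A : Set} (p : A → Bool) (f : A → ℕ) (l : List A) →
    Σ[ filterᵇ p l ] f + Σ[ filterᵇ (λ a → not (p a)) l ] f ≡ Σ[ l ] f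
  Σ-filter-split p f [] = refl
  Σ-filter-split p f (x ∷ l) with p x
  ... | true = trans (+-assoc (f x) _ _) (cong (f x +_) (Σ-filter-split p f l))
  ... | false = trans (sym (+-suc' (Σ[ filterᵇ p l ] f) (f x) _)) (cong (f x +_) (Σ-filter-split p f l))
    where
    +-suc' : ∀ a b c → b + (a + c) ≡ a + (b + c)
    +-suc' = solve-∀

  any-false : {A : Set} (p : A → Bool) {L : List A} → All (λ a → p a ≡ false) L → any p L ≡ false
  any-false p [] = refl
  any-false p (h ∷ hs) rewrite h = any-false p hs

  any-0 : {A : Set} (p : A → Bool) (L : List A) → Σ[ L ] (λ a → ⟦ p a ⟧) ≡ 0 → any p L ≡ false
  any-0 p [] e = refl
  any-0 p (a ∷ L) e with p a
  ... | false = any-0 p L e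

  any-1 : {A : Set} (p : A → Bool) (L : List A) → Σ[ L ] (λ a → ⟦ p a ⟧) ≡ 1 → any p L ≡ true
  any-1 p (a ∷ L) e with p a
  ... | true = refl
  ... | false = any-1 p L e

  All-filter : {A : Set} {P : A → Set} (p : A → Bool) {l : List A} → All P l → All (λ a → P a × (p a ≡ true)) (filterᵇ p l)
  All-filter p [] = []
  All-filter p {x ∷ l} (h ∷ hs) with p x in e
  ... | true = (h , e) ∷ All-filter p hs
  ... | false = All-filter p hs

  ∨-false-l : ∀ {a b} → a ∨ b ≡ false → a ≡ false
  ∨-false-l {false} e = refl
  ∨-false-r : ∀ {a b} → a ∨ b ≡ false → b ≡ false
  ∨-false-r {false} e = e

  true≢false : true ≡ false → {X : Set} → X
  true≢false ()

  ∨-true-r : ∀ a {b} → b ≡ true → a ∨ b ≡ true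
  ∨-true-r true e = refl
  ∨-true-r false e = e

  allList : {A : Set} {P : A → Set} → (∀ y → P y) → (l : List A) → All P l
  allList h [] = []
  allList h (x ∷ l) = h x ∷ allList h l

module Orderings where

  open import Data.Bool using (Bool; true; false; not; if_then_else_)
  open import Data.Nat using (ℕ; suc; _+_; _*_; ≢-nonZero)
  open import Data.Nat.Properties using (*-assoc; *-comm; *-cancelʳ-≡; m*n≡0⇒m≡0∨n≡0)
  open import Data.Sum using ([_,_]′)
  open import Data.List using (List; []; _∷_; map; length; filterᵇ; _++_)
  open import Data.List.Relation.Binary.Permutation.Propositional
    using (_↭_; prep; swap; ↭-sym) renaming (refl to ↭-refl; trans to ↭-trans)
  open import Data.List.Relation.Binary.Permutation.Propositional.Properties using (↭-length; All-resp-↭)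
  open import Data.List.Relation.Unary.All as All using (All; []; _∷_)
  open import Data.List.Relation.Unary.All.Properties using (map⁺; concat⁺)
  open import Function using (_∘_)
  open import Relation.Binary.PropositionalEquality using (_≡_; _≢_; refl; sym; trans; cong; cong₂)
  open import Data.Nat.Tactic.RingSolver using (solve-∀)
  open import Defs using (insertions; orderings)
  open ListSums

  open Relation.Binary.PropositionalEquality.≡-Reasoning

  private variable A : Set

  -- The sum of f over all orderings of L; for f an indicator this counts the
  -- orderings in an event, and #ord L is the number of all orderings.
  sumOrd : (List A → ℕ) → List A → ℕ
  sumOrd f L = Σ[ orderings L ] f

  #ord : List A → ℕ
  #ord = sumOrd (λ _ → 1)

  sumOrd-cons : (f : List A → ℕ) (x : A) (L : List A) →
    sumOrd f (x ∷ L) ≡ sumOrd (λ τ → Σ[ insertions x τ ] f) L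
  sumOrd-cons f x L = Σ-concatMap (insertions x) (orderings L) f

  insert-twice : (x y : A) (f : List A → ℕ) → List A → ℕ
  insert-twice x y f τ = Σ[ insertions y τ ] (λ ρ → Σ[ insertions x ρ ] f)

  insert-twice-comm : (x y : A) (f : List A → ℕ) (τ : List A) →
    insert-twice x y f τ ≡ insert-twice y x f τ
  insert-twice-comm x y f [] = comm (f (x ∷ y ∷ [])) (f (y ∷ x ∷ []))
    where
    comm : ∀ a b → a + (b + 0) + 0 ≡ b + (a + 0) + 0
    comm = solve-∀
  insert-twice-comm x y f (z ∷ τ) = begin
    insert-twice x y f (z ∷ τ)
      ≡⟨ unfold x y ⟩
    f (x ∷ y ∷ z ∷ τ) + (f (y ∷ x ∷ z ∷ τ) + E x y) + (E y x + insert-twice x y (f ∘ (z ∷_)) τ)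
      ≡⟨ cong (λ t → f (x ∷ y ∷ z ∷ τ) + (f (y ∷ x ∷ z ∷ τ) + E x y) + (E y x + t))
              (insert-twice-comm x y (f ∘ (z ∷_)) τ) ⟩
    f (x ∷ y ∷ z ∷ τ) + (f (y ∷ x ∷ z ∷ τ) + E x y) + (E y x + insert-twice y x (f ∘ (z ∷_)) τ)
      ≡⟨ rearrange (f (x ∷ y ∷ z ∷ τ)) (f (y ∷ x ∷ z ∷ τ)) (E x y) (E y x) _ ⟩
    f (y ∷ x ∷ z ∷ τ) + (f (x ∷ y ∷ z ∷ τ) + E y x) + (E x y + insert-twice y x (f ∘ (z ∷_)) τ)
      ≡⟨ sym (unfold y x) ⟩
    insert-twice y x f (z ∷ τ) ∎
    where
    rearrange : ∀ a b c d e → a + (b + c) + (d + e) ≡ b + (a + d) + (c + e)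
    rearrange = solve-∀
    -- orderings where p lands behind z while q stays in front of z
    E : _ → _ → ℕ
    E p q = Σ[ insertions p τ ] (λ π → f (q ∷ z ∷ π))
    unfold : ∀ p q → insert-twice p q f (z ∷ τ) ≡
      f (p ∷ q ∷ z ∷ τ) + (f (q ∷ p ∷ z ∷ τ) + E p q) + (E q p + insert-twice p q (f ∘ (z ∷_)) τ)
    unfold p q = cong₂ _+_ q-in-front q-behind
      where
      q-in-front : Σ[ insertions p (q ∷ z ∷ τ) ] f ≡ f (p ∷ q ∷ z ∷ τ) + (f (q ∷ p ∷ z ∷ τ) + E p q)
      q-in-front = cong (λ t → f (p ∷ q ∷ z ∷ τ) + (f (q ∷ p ∷ z ∷ τ) + t))
        (trans (Σ-map (map (z ∷_) (insertions p τ)) f (q ∷_)) (Σ-map (insertions p τ) (f ∘ (q ∷_)) (z ∷_)))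
      q-behind : Σ[ map (z ∷_) (insertions q τ) ] (λ ρ → Σ[ insertions p ρ ] f) ≡
        E q p + insert-twice p q (f ∘ (z ∷_)) τ
      q-behind = begin
        Σ[ map (z ∷_) (insertions q τ) ] (λ ρ → Σ[ insertions p ρ ] f)
          ≡⟨ Σ-map (insertions q τ) (λ ρ → Σ[ insertions p ρ ] f) (z ∷_) ⟩
        Σ[ insertions q τ ] (λ ρ → f (p ∷ z ∷ ρ) + Σ[ map (z ∷_) (insertions p ρ) ] f)
          ≡⟨ Σ-cong (insertions q τ) (λ ρ → cong (f (p ∷ z ∷ ρ) +_) (Σ-map (insertions p ρ) f (z ∷_))) ⟩
        Σ[ insertions q τ ] (λ ρ → f (p ∷ z ∷ ρ) + Σ[ insertions p ρ ] (f ∘ (z ∷_)))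
          ≡⟨ Σ-+ (insertions q τ) _ _ ⟩
        E q p + insert-twice p q (f ∘ (z ∷_)) τ ∎

  sumOrd-↭ : {xs ys : List A} → xs ↭ ys → (f : List A → ℕ) → sumOrd f xs ≡ sumOrd f ys
  sumOrd-↭ ↭-refl f = refl
  sumOrd-↭ (prep {xs = xs} {ys = ys} x p) f =
    trans (sumOrd-cons f x xs) (trans (sumOrd-↭ p _) (sym (sumOrd-cons f x ys)))
  sumOrd-↭ (swap {xs = xs} {ys = ys} x y p) f = begin
    sumOrd f (x ∷ y ∷ xs)                         ≡⟨ sumOrd-cons f x (y ∷ xs) ⟩
    sumOrd (λ τ → Σ[ insertions x τ ] f) (y ∷ xs) ≡⟨ sumOrd-cons _ y xs ⟩
    sumOrd (insert-twice x y f) xs                ≡⟨ Σ-cong (orderings xs) (insert-twice-comm x y f) ⟩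
    sumOrd (insert-twice y x f) xs                ≡⟨ sumOrd-↭ p _ ⟩
    sumOrd (insert-twice y x f) ys                ≡⟨ sym (sumOrd-cons _ x ys) ⟩
    sumOrd (λ τ → Σ[ insertions y τ ] f) (x ∷ ys) ≡⟨ sym (sumOrd-cons f y (x ∷ ys)) ⟩
    sumOrd f (y ∷ x ∷ ys)                         ∎
  sumOrd-↭ (↭-trans p q) f = trans (sumOrd-↭ p f) (sumOrd-↭ q f)

  insertions-↭ : (x : A) (τ : List A) → All (λ ρ → ρ ↭ (x ∷ τ)) (insertions x τ)
  insertions-↭ x [] = ↭-refl ∷ []
  insertions-↭ x (y ∷ ys) =
    ↭-refl ∷ map⁺ (All.map (λ p → ↭-trans (prep y p) (swap y x ↭-refl)) (insertions-↭ x ys))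

  orderings-↭ : (L : List A) → All (λ τ → τ ↭ L) (orderings L)
  orderings-↭ [] = ↭-refl ∷ []
  orderings-↭ (x ∷ L) = concat⁺ (map⁺ (All.map
    (λ p → All.map (λ q → ↭-trans q (prep x p)) (insertions-↭ x _)) (orderings-↭ L)))

  sumOrd-cong : (L : List A) {f g : List A → ℕ} → (∀ τ → τ ↭ L → f τ ≡ g τ) → sumOrd f L ≡ sumOrd g L
  sumOrd-cong L h = Σ-congAll (All.map (λ {τ} p → h τ p) (orderings-↭ L))

  sumOrd-length : (L : List A) (k : ℕ) (g : List A → ℕ) →
    sumOrd (λ τ → (k + length τ) * g τ) L ≡ (k + length L) * sumOrd g L
  sumOrd-length L k g =
    trans (sumOrd-cong L (λ τ p → cong (λ n → (k + n) * g τ) (↭-length p))) (Σ-*ˡ (orderings L) (k + length L) g)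

  insertions-ignored : (keep : A → Bool) (x : A) → keep x ≡ false → (g : List A → ℕ) (τ : List A) →
    Σ[ insertions x τ ] (g ∘ filterᵇ keep) ≡ suc (length τ) * g (filterᵇ keep τ)
  insertions-ignored keep x kx g [] = cong (λ l → g l + 0) (filter-reject keep [] kx)
  insertions-ignored keep x kx g (y ∷ ys) = begin
    g (filterᵇ keep (x ∷ y ∷ ys)) + Σ[ map (y ∷_) (insertions x ys) ] (g ∘ filterᵇ keep)
      ≡⟨ cong₂ _+_ (cong g (filter-reject keep (y ∷ ys) kx)) (Σ-map (insertions x ys) (g ∘ filterᵇ keep) (y ∷_)) ⟩
    g F + Σ[ insertions x ys ] (λ ρ → g (filterᵇ keep (y ∷ ρ)))
      ≡⟨ cong (g F +_) (Σ-cong (insertions x ys) (λ ρ → cong g (filter-cons keep y ρ))) ⟩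
    g F + Σ[ insertions x ys ] ((g ∘ consIfKept) ∘ filterᵇ keep)
      ≡⟨ cong (g F +_) (insertions-ignored keep x kx (g ∘ consIfKept) ys) ⟩
    g F + suc (length ys) * g (consIfKept (filterᵇ keep ys))
      ≡⟨ cong (λ t → g F + suc (length ys) * g t) (sym (filter-cons keep y ys)) ⟩
    g F + suc (length ys) * g F ∎
    where
    F = filterᵇ keep (y ∷ ys)
    consIfKept : List _ → List _
    consIfKept l = if keep y then y ∷ l else l

  sumOrd-ignored : (keep : A → Bool) (x : A) → keep x ≡ false → (g : List A → ℕ) (xs : List A) →
    sumOrd (g ∘ filterᵇ keep) (x ∷ xs) ≡ suc (length xs) * sumOrd (g ∘ filterᵇ keep) xs
  sumOrd-ignored keep x kx g xs = begin
    sumOrd (g ∘ filterᵇ keep) (x ∷ xs)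
      ≡⟨ sumOrd-cons _ x xs ⟩
    sumOrd (λ τ → Σ[ insertions x τ ] (g ∘ filterᵇ keep)) xs
      ≡⟨ Σ-cong (orderings xs) (insertions-ignored keep x kx g) ⟩
    sumOrd (λ τ → (1 + length τ) * g (filterᵇ keep τ)) xs
      ≡⟨ sumOrd-length xs 1 _ ⟩
    suc (length xs) * sumOrd (g ∘ filterᵇ keep) xs ∎

  #ord-cons : (x : A) (xs : List A) → #ord (x ∷ xs) ≡ suc (length xs) * #ord xs
  #ord-cons x xs = sumOrd-ignored (λ _ → false) x refl (λ _ → 1) xs

  #ord≢0 : (L : List A) → #ord L ≢ 0
  #ord≢0 [] ()
  #ord≢0 (x ∷ L) e = [ (λ ()) , #ord≢0 L ]′ (m*n≡0⇒m≡0∨n≡0 (suc (length L)) (trans (sym (#ord-cons x L)) e))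

  -- Restriction principle: for a uniformly random ordering of L, the induced
  -- ordering of the kept elements K = filterᵇ keep L is a uniformly random
  -- ordering of K.
  move-front : (x : A) (N K : List A) → x ∷ N ++ K ↭ N ++ x ∷ K
  move-front x [] K = ↭-refl
  move-front x (n ∷ N) K = ↭-trans (swap x n ↭-refl) (prep n (move-front x N K))

  partition-↭ : (keep : A → Bool) (L : List A) → L ↭ filterᵇ (not ∘ keep) L ++ filterᵇ keep L
  partition-↭ keep [] = ↭-refl
  partition-↭ keep (x ∷ L) with keep x
  ... | true = ↭-trans (prep x (partition-↭ keep L)) (move-front x _ _)
  ... | false = prep x (partition-↭ keep L)

  restrict-prefix : (keep : A → Bool) (g : List A → ℕ) (N K : List A) →
    All (λ x → not (keep x) ≡ true) N → All (λ x → keep x ≡ true) K →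
    sumOrd (g ∘ filterᵇ keep) (N ++ K) * #ord K ≡ sumOrd g K * #ord (N ++ K)
  restrict-prefix keep g [] K aN aK = cong (_* #ord K)
    (sumOrd-cong K (λ τ p → cong g (filter-id keep (All-resp-↭ (↭-sym p) aK))))
  restrict-prefix keep g (x ∷ N) K (e ∷ aN) aK = begin
    sumOrd (g ∘ filterᵇ keep) (x ∷ N ++ K) * #ord K
      ≡⟨ cong (_* #ord K) (sumOrd-ignored keep x (not-true e) g (N ++ K)) ⟩
    n * sumOrd (g ∘ filterᵇ keep) (N ++ K) * #ord K
      ≡⟨ *-assoc n (sumOrd (g ∘ filterᵇ keep) (N ++ K)) (#ord K) ⟩
    n * (sumOrd (g ∘ filterᵇ keep) (N ++ K) * #ord K)
      ≡⟨ cong (n *_) (restrict-prefix keep g N K aN aK) ⟩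
    n * (sumOrd g K * #ord (N ++ K))
      ≡⟨ exchange n (sumOrd g K) (#ord (N ++ K)) ⟩
    sumOrd g K * (n * #ord (N ++ K))
      ≡⟨ cong (sumOrd g K *_) (sym (#ord-cons x (N ++ K))) ⟩
    sumOrd g K * #ord (x ∷ N ++ K) ∎
    where
    n = suc (length (N ++ K))
    not-true : ∀ {b} → not b ≡ true → b ≡ false
    not-true {false} _ = refl
    exchange : ∀ a b c → a * (b * c) ≡ b * (a * c)
    exchange = solve-∀

  restrict : (keep : A → Bool) (g : List A → ℕ) (L : List A) →
    sumOrd (g ∘ filterᵇ keep) L * #ord (filterᵇ keep L) ≡ sumOrd g (filterᵇ keep L) * #ord L
  restrict keep g L = begin
    sumOrd (g ∘ filterᵇ keep) L * #ord K       ≡⟨ cong (_* #ord K) (sumOrd-↭ (partition-↭ keep L) _) ⟩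
    sumOrd (g ∘ filterᵇ keep) (N ++ K) * #ord K ≡⟨ restrict-prefix keep g N K (filter-All (not ∘ keep) L) (filter-All keep L) ⟩
    sumOrd g K * #ord (N ++ K)                  ≡⟨ cong (sumOrd g K *_) (sym (sumOrd-↭ (partition-↭ keep L) _)) ⟩
    sumOrd g K * #ord L                         ∎
    where
    K = filterᵇ keep L
    N = filterᵇ (not ∘ keep) L

  restrict-event : (keep : A → Bool) (g : List A → ℕ) (L : List A) (d : ℕ) →
    sumOrd g (filterᵇ keep L) * d ≡ #ord (filterᵇ keep L) →
    sumOrd (g ∘ filterᵇ keep) L * d ≡ #ord L
  restrict-event keep g L d event = *-cancelʳ-≡ (X * d) M (#ord K) {{≢-nonZero (#ord≢0 K)}} (begin
    X * d * #ord K ≡⟨ swap-last X d (#ord K) ⟩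
    X * #ord K * d ≡⟨ cong (_* d) (restrict keep g L) ⟩
    Z * M * d      ≡⟨ swap-last Z M d ⟩
    Z * d * M      ≡⟨ cong (_* M) event ⟩
    #ord K * M     ≡⟨ *-comm (#ord K) M ⟩
    M * #ord K     ∎)
    where
    K = filterᵇ keep L
    X = sumOrd (g ∘ filterᵇ keep) L
    Z = sumOrd g K
    M = #ord L
    swap-last : ∀ a b c → a * b * c ≡ a * c * b
    swap-last = solve-∀

module FirstElements where

  open import Data.Bool using (Bool; true; false; not; if_then_else_)
  open import Data.Nat using (ℕ; suc; _+_; _*_; pred)
  open import Data.Nat.Properties using (+-identityʳ; *-comm)
  open import Data.List using (List; []; _∷_; map; length; filterᵇ)
  open import Data.List.Relation.Binary.Permutation.Propositional
    using (_↭_; prep) renaming (refl to ↭-refl; trans to ↭-trans; swap to ↭-swap)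
  open import Data.List.Relation.Binary.Permutation.Propositional.Properties using (↭-length)
  open import Data.List.Relation.Unary.All as All using (All; []; _∷_)
  open import Relation.Binary.PropositionalEquality using (_≡_; refl; sym; trans; cong; cong₂)
  open import Data.Nat.Tactic.RingSolver using (solve-∀)
  open import Defs using (insertions)
  open ListSums
  open Orderings

  open Relation.Binary.PropositionalEquality.≡-Reasoning

  module Occurrences {A : Set} (_==_ : A → A → Bool)
    (==-sound : ∀ x y → x == y ≡ true → x ≡ y) (==-refl : ∀ x → x == x ≡ true) where

    count : A → List A → ℕ
    count x l = Σ[ l ] (λ e → ⟦ x == e ⟧)

    startsWith : A → List A → ℕ
    startsWith x [] = 0
    startsWith x (e ∷ _) = ⟦ x == e ⟧

    startsWith₂ : A → A → List A → ℕ
    startsWith₂ x y [] = 0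
    startsWith₂ x y (e ∷ r) = if x == e then startsWith y r else 0

    ==-sym : ∀ x y → x == y ≡ y == x
    ==-sym x y with x == y in e | y == x in e'
    ... | true | true = refl
    ... | false | false = refl
    ... | true | false rewrite ==-sound x y e = sym (trans (sym e') (==-refl y))
    ... | false | true rewrite ==-sound y x e' = trans (sym e) (==-refl x)

    count-0-head : ∀ x e l → count x (e ∷ l) ≡ 0 → x == e ≡ false
    count-0-head x e l c with x == e
    ... | false = refl

    count-insertions : (x z : A) (τ : List A) →
      All (λ ρ → count z ρ ≡ ⟦ z == x ⟧ + count z τ) (insertions x τ)
    count-insertions x z τ = All.map (Σ-↭ _) (insertions-↭ x τ)

    insertions-startsWith : (x : A) (τ : List A) → count x τ ≡ 0 → Σ[ insertions x τ ] (startsWith x) ≡ 1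
    insertions-startsWith x [] c rewrite ==-refl x = refl
    insertions-startsWith x (y ∷ ys) c rewrite ==-refl x =
      cong suc (trans (Σ-map (insertions x ys) (startsWith x) (y ∷_))
        (Σ-zero (insertions x ys) (λ _ → cong ⟦_⟧ (count-0-head x y ys c))))

    insertions-startsWith₂ : (x y : A) (τ : List A) → count x τ ≡ 0 →
      Σ[ insertions x τ ] (startsWith₂ x y) ≡ startsWith y τ
    insertions-startsWith₂ x y [] c = cong (_+ 0) (if-true (==-refl x))
    insertions-startsWith₂ x y (z ∷ zs) c = trans
      (cong₂ _+_ (if-true (==-refl x))
        (trans (Σ-map (insertions x zs) (startsWith₂ x y) (z ∷_))
               (Σ-zero (insertions x zs) (λ _ → if-false (count-0-head x z zs c)))))
      (+-identityʳ _)

    count-filter : (x : A) (p : A → Bool) → p x ≡ true → (L : List A) → count x (filterᵇ p L) ≡ count x L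
    count-filter x p px [] = refl
    count-filter x p px (e ∷ L) with p e in pe
    ... | true = cong (⟦ x == e ⟧ +_) (count-filter x p px L)
    ... | false with x == e in xe
    ...   | false = count-filter x p px L
    ...   | true with () ← trans (sym px) (trans (cong p (==-sound x e xe)) pe)

    delete : A → List A → List A
    delete x = filterᵇ (λ e → not (x == e))

    count-delete-self : (x : A) (K : List A) → count x (delete x K) ≡ 0
    count-delete-self x [] = refl
    count-delete-self x (k ∷ K) with x == k in e
    ... | true = count-delete-self x K
    ... | false rewrite e = count-delete-self x K

    count-delete-other : (x y : A) (K : List A) → y == x ≡ false → count y (delete x K) ≡ count y K
    count-delete-other x y [] h = refl
    count-delete-other x y (k ∷ K) h with x == k in e
    ... | true rewrite ==-sound x k e | h = count-delete-other k y K h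
    ... | false = cong (⟦ y == k ⟧ +_) (count-delete-other x y K h)

    count-0-delete : (x : A) (K : List A) → count x K ≡ 0 → delete x K ≡ K
    count-0-delete x [] c = refl
    count-0-delete x (k ∷ K) c with x == k | c
    ... | false | c' = cong (k ∷_) (count-0-delete x K c')

    delete-↭ : (x : A) (K : List A) → count x K ≡ 1 → K ↭ x ∷ delete x K
    delete-↭ x (k ∷ K) c with x == k in e
    ... | true rewrite ==-sound x k e | count-0-delete k K (cong pred c) = ↭-refl
    ... | false = ↭-trans (prep k (delete-↭ x K c)) (↭-swap k x ↭-refl)

    startsWith-front : (x : A) (R : List A) → count x R ≡ 0 → sumOrd (startsWith x) (x ∷ R) ≡ #ord R
    startsWith-front x R c = trans (sumOrd-cons (startsWith x) x R)
      (sumOrd-cong R (λ τ q → insertions-startsWith x τ (trans (Σ-↭ _ q) c)))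

    startsWith₂-front : (x y : A) (R : List A) → x == y ≡ false → count x R ≡ 0 → count y R ≡ 0 →
      sumOrd (startsWith₂ x y) (x ∷ y ∷ R) ≡ #ord R
    startsWith₂-front x y R xy cx cy = trans (sumOrd-cons (startsWith₂ x y) x (y ∷ R)) (trans (sumOrd-cons _ y R)
      (sumOrd-cong R (λ τ q → trans
        (Σ-congAll (All.map (λ {τ'} e → insertions-startsWith₂ x y τ'
          (trans e (cong₂ _+_ (cong ⟦_⟧ xy) (trans (Σ-↭ _ q) cx)))) (count-insertions y x τ)))
        (insertions-startsWith y τ (trans (Σ-↭ _ q) cy)))))

    startsWith-prob : (x : A) (K : List A) → count x K ≡ 1 → sumOrd (startsWith x) K * length K ≡ #ord K
    startsWith-prob x K c = begin
      sumOrd (startsWith x) K * length K             ≡⟨ cong₂ _*_ (sumOrd-↭ p (startsWith x)) (↭-length p) ⟩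
      sumOrd (startsWith x) (x ∷ R) * suc (length R) ≡⟨ cong (_* suc (length R)) (startsWith-front x R (count-delete-self x K)) ⟩
      #ord R * suc (length R)                        ≡⟨ *-comm (#ord R) _ ⟩
      suc (length R) * #ord R                        ≡⟨ sym (#ord-cons x R) ⟩
      #ord (x ∷ R)                                   ≡⟨ sym (sumOrd-↭ p _) ⟩
      #ord K                                         ∎
      where
      R = delete x K
      p = delete-↭ x K c

    startsWith₂-prob : (x y : A) (K : List A) → count x K ≡ 1 → count y K ≡ 1 → x == y ≡ false →
      sumOrd (startsWith₂ x y) K * (length K * pred (length K)) ≡ #ord K
    startsWith₂-prob x y K cx cy xy = begin
      sumOrd (startsWith₂ x y) K * (length K * pred (length K))
        ≡⟨ cong₂ (λ a n → a * (n * pred n)) (sumOrd-↭ p (startsWith₂ x y)) (↭-length p) ⟩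
      sumOrd (startsWith₂ x y) (x ∷ y ∷ R) * (suc (suc r) * suc r)
        ≡⟨ cong (_* (suc (suc r) * suc r)) (startsWith₂-front x y R xy cx₀ (count-delete-self y R₁)) ⟩
      #ord R * (suc (suc r) * suc r)  ≡⟨ rearrange (#ord R) (suc (suc r)) (suc r) ⟩
      suc (suc r) * (suc r * #ord R)  ≡⟨ cong (suc (suc r) *_) (sym (#ord-cons y R)) ⟩
      suc (suc r) * #ord (y ∷ R)      ≡⟨ sym (#ord-cons x (y ∷ R)) ⟩
      #ord (x ∷ y ∷ R)                ≡⟨ sym (sumOrd-↭ p _) ⟩
      #ord K                          ∎
      where
      R₁ = delete x K
      R = delete y R₁
      r = length R
      p : K ↭ x ∷ y ∷ R
      p = ↭-trans (delete-↭ x K cx) (prep x (delete-↭ y R₁ (trans (count-delete-other x y K (trans (==-sym y x) xy)) cy)))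
      cx₀ : count x R ≡ 0
      cx₀ = trans (count-delete-other y x R₁ xy) (count-delete-self x K)
      rearrange : ∀ a b c → a * (b * c) ≡ b * (c * a)
      rearrange = solve-∀

module Equality where

  open import Data.Bool using (Bool; true; _∧_; T)
  open import Data.Bool.Properties using (T-≡)
  open import Data.Nat using (_≡ᵇ_)
  open import Data.Nat.Properties using (≡ᵇ⇒≡; ≡⇒≡ᵇ)
  open import Data.Product using (_,_)
  open import Function.Bundles using (Equivalence)
  open import Relation.Binary.PropositionalEquality using (_≡_; refl; cong₂)
  open import Defs
  open ListSums
  open Orderings
  open FirstElements

  ≡ᵇ-sound : ∀ m n → (m ≡ᵇ n) ≡ true → m ≡ n
  ≡ᵇ-sound m n e = ≡ᵇ⇒≡ m n (Equivalence.from T-≡ e)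

  ≡ᵇ-refl : ∀ m → (m ≡ᵇ m) ≡ true
  ≡ᵇ-refl m = Equivalence.to T-≡ (≡⇒≡ᵇ m m refl)

  open Occurrences _≡ᵇ_ ≡ᵇ-sound ≡ᵇ-refl public
    using () renaming (count to #occ; ==-sym to ≡ᵇ-sym)

  -- Boolean equality of edges (as ordered pairs).  It is kept opaque so
  -- that only the stated equations are used about it.
  opaque
    eqE : Edge → Edge → Bool
    eqE (a , b) (c , d) = (a ≡ᵇ c) ∧ (b ≡ᵇ d)

    eqE-pair : ∀ a b c d → eqE (a , b) (c , d) ≡ ((a ≡ᵇ c) ∧ (b ≡ᵇ d))
    eqE-pair a b c d = refl

    eqE-sound : ∀ e f → eqE e f ≡ true → e ≡ f
    eqE-sound (a , b) (c , d) h with a ≡ᵇ c in e₁ | b ≡ᵇ d in e₂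
    ... | true | true = cong₂ _,_ (≡ᵇ-sound a c e₁) (≡ᵇ-sound b d e₂)

    eqE-refl : ∀ e → eqE e e ≡ true
    eqE-refl (a , b) rewrite ≡ᵇ-refl a | ≡ᵇ-refl b = refl

  open Occurrences eqE eqE-sound eqE-refl public
    renaming (==-sym to eqE-sym)

module ForestTrees where

  open import Data.Bool using (Bool; true; false; not; _∨_; _∧_; if_then_else_)
  open import Data.Bool.Properties using (∨-assoc; ∨-comm; ∨-identityʳ; ∧-comm)
  open import Data.Nat using (ℕ; zero; suc; _+_; _*_; _≡ᵇ_)
  open import Data.Nat.Properties using (+-comm; +-assoc; +-suc; +-identityʳ; +-cancelʳ-≡; *-zeroʳ)
  open import Data.List using (List; []; _∷_; map; concat; concatMap; length; filterᵇ; _++_; deduplicateᵇ)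
  open import Data.List.Relation.Binary.Permutation.Propositional
    using (_↭_; prep; swap; ↭-sym) renaming (refl to ↭-refl; trans to ↭-trans)
  open import Data.List.Relation.Binary.Permutation.Propositional.Properties using (All-resp-↭)
  open import Data.List.Relation.Unary.All as All using (All; []; _∷_)
  open import Data.List.Relation.Unary.All.Properties using (map⁺)
  open import Data.List.Properties using (length-map)
  open import Data.Product using (_×_; _,_; proj₁; proj₂)
  open import Data.Sum using (_⊎_; inj₁; inj₂)
  open import Relation.Binary.PropositionalEquality using (_≡_; refl; sym; trans; cong; cong₂)
  open import Relation.Nullary.Decidable.Core using (T?; ¬?)
  open import Data.Nat.Tactic.RingSolver using (solve-∀)
  open import Data.Bool.ListAction using (any)
  open import Defs
  open ListSums
  open Orderings
  open FirstElements

  open Equality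

  open Relation.Binary.PropositionalEquality.≡-Reasoning

  -- For an ordering σ of a loopless graph G, the
  -- number of trees equals the number of edges of σ both of whose endpoints
  -- are new when the edge is reached (numTrees≡#bothNew).  Two counts give
  -- this: every kept edge merges two blocks of the vertex partition
  -- (components+kept), and kept edges plus "both-new" edges count the
  -- vertices (kept+bothNew).

  endpoints : List Edge → List ℕ
  endpoints = concatMap (λ { (u , v) → u ∷ v ∷ [] })

  fresh : List ℕ → ℕ → Bool
  fresh s x = not (x ∈ᵇ s)

  #new : List ℕ → List ℕ → ℕ
  #new s [] = 0
  #new s (x ∷ xs) = ⟦ fresh s x ⟧ + #new (x ∷ s) xs

  #new-cong : (xs : List ℕ) (s s' : List ℕ) → (∀ x → x ∈ᵇ s ≡ x ∈ᵇ s') → #new s xs ≡ #new s' xs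
  #new-cong [] s s' h = refl
  #new-cong (x ∷ xs) s s' h = cong₂ _+_ (cong (λ b → ⟦ not b ⟧) (h x))
    (#new-cong xs (x ∷ s) (x ∷ s') (λ z → cong ((z ≡ᵇ x) ∨_) (h z)))

  #new-swap : ∀ x y s → ⟦ fresh s x ⟧ + ⟦ fresh (x ∷ s) y ⟧ ≡ ⟦ fresh s y ⟧ + ⟦ fresh (y ∷ s) x ⟧
  #new-swap x y s with x ≡ᵇ y in e
  ... | true rewrite ≡ᵇ-sound x y e | ≡ᵇ-refl y = refl
  ... | false rewrite trans (≡ᵇ-sym y x) e with x ∈ᵇ s | y ∈ᵇ s
  ...   | true | true = refl
  ...   | true | false = refl
  ...   | false | true = refl
  ...   | false | false = refl

  #new-↭ : {xs ys : List ℕ} → xs ↭ ys → ∀ s → #new s xs ≡ #new s ys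
  #new-↭ ↭-refl s = refl
  #new-↭ (prep x p) s = cong (⟦ fresh s x ⟧ +_) (#new-↭ p (x ∷ s))
  #new-↭ (swap {xs = xs} {ys = ys} x y p) s = begin
    ⟦ fresh s x ⟧ + (⟦ fresh (x ∷ s) y ⟧ + #new (y ∷ x ∷ s) xs) ≡⟨ sym (+-assoc ⟦ fresh s x ⟧ ⟦ fresh (x ∷ s) y ⟧ (#new (y ∷ x ∷ s) xs)) ⟩
    ⟦ fresh s x ⟧ + ⟦ fresh (x ∷ s) y ⟧ + #new (y ∷ x ∷ s) xs
      ≡⟨ cong₂ _+_ (#new-swap x y s) (trans (#new-↭ p (y ∷ x ∷ s)) (#new-cong ys (y ∷ x ∷ s) (x ∷ y ∷ s) (λ z → sym (∨-swap (z ≡ᵇ x) (z ≡ᵇ y) (z ∈ᵇ s))))) ⟩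
    ⟦ fresh s y ⟧ + ⟦ fresh (y ∷ s) x ⟧ + #new (x ∷ y ∷ s) ys ≡⟨ +-assoc ⟦ fresh s y ⟧ ⟦ fresh (y ∷ s) x ⟧ (#new (x ∷ y ∷ s) ys) ⟩
    ⟦ fresh s y ⟧ + (⟦ fresh (y ∷ s) x ⟧ + #new (x ∷ y ∷ s) ys) ∎
    where
    ∨-swap : ∀ a b c → a ∨ (b ∨ c) ≡ b ∨ (a ∨ c)
    ∨-swap true true c = refl
    ∨-swap true false c = refl
    ∨-swap false true c = refl
    ∨-swap false false c = refl
  #new-↭ (↭-trans p q) s = trans (#new-↭ p s) (#new-↭ q s)

  endpoints-↭ : {σ G : List Edge} → σ ↭ G → endpoints σ ↭ endpoints G
  endpoints-↭ ↭-refl = ↭-refl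
  endpoints-↭ (prep (u , v) p) = prep u (prep v (endpoints-↭ p))
  endpoints-↭ (swap (u , v) (u' , v') p) =
    ↭-trans (prep u (swap v u' ↭-refl))
    (↭-trans (swap u u' ↭-refl)
    (↭-trans (prep u' (prep u (swap v v' ↭-refl)))
    (↭-trans (prep u' (swap u v' ↭-refl))
    (prep u' (prep v' (prep u (prep v (endpoints-↭ p))))))))
  endpoints-↭ (↭-trans p q) = ↭-trans (endpoints-↭ p) (endpoints-↭ q)

  dedup-cons : (y : ℕ) (ys : List ℕ) → deduplicateᵇ _≡ᵇ_ (y ∷ ys) ≡ y ∷ filterᵇ (λ z → not (y ≡ᵇ z)) (deduplicateᵇ _≡ᵇ_ ys)
  dedup-cons y ys = cong (y ∷_) (filter-ext (λ z → ¬? (T? (y ≡ᵇ z))) (λ z → not (y ≡ᵇ z)) (λ _ → refl) (deduplicateᵇ _≡ᵇ_ ys))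

  fresh-cons : ∀ x s z → not (x ≡ᵇ z) ∧ fresh s z ≡ fresh (x ∷ s) z
  fresh-cons x s z rewrite ≡ᵇ-sym x z with z ≡ᵇ x
  ... | true = refl
  ... | false = refl

  length-fresh-dedup : (xs s : List ℕ) → length (filterᵇ (fresh s) (deduplicateᵇ _≡ᵇ_ xs)) ≡ #new s xs
  length-fresh-dedup [] s = refl
  length-fresh-dedup (x ∷ xs) s = begin
    length (filterᵇ (fresh s) (deduplicateᵇ _≡ᵇ_ (x ∷ xs)))
      ≡⟨ cong (λ l → length (filterᵇ (fresh s) l)) (dedup-cons x xs) ⟩
    length (filterᵇ (fresh s) (x ∷ filterᵇ (λ z → not (x ≡ᵇ z)) D))
      ≡⟨ length-filter-cons (fresh s) x _ ⟩
    ⟦ fresh s x ⟧ + length (filterᵇ (fresh s) (filterᵇ (λ z → not (x ≡ᵇ z)) D))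
      ≡⟨ cong (λ l → ⟦ fresh s x ⟧ + length l) (trans (filter-filter (fresh s) (λ z → not (x ≡ᵇ z)) D)
            (filter-cong _ (fresh (x ∷ s)) (fresh-cons x s) D)) ⟩
    ⟦ fresh s x ⟧ + length (filterᵇ (fresh (x ∷ s)) D)
      ≡⟨ cong (⟦ fresh s x ⟧ +_) (length-fresh-dedup xs (x ∷ s)) ⟩
    #new s (x ∷ xs) ∎
    where
    D = deduplicateᵇ _≡ᵇ_ xs

  length-dedup : (xs : List ℕ) → length (deduplicateᵇ _≡ᵇ_ xs) ≡ #new [] xs
  length-dedup xs = trans (cong length (sym (filter-true (deduplicateᵇ _≡ᵇ_ xs)))) (length-fresh-dedup xs [])

  #bothNew : List ℕ → List Edge → ℕ
  #bothNew s [] = 0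
  #bothNew s ((u , v) ∷ σ) = ⟦ fresh s u ∧ fresh s v ⟧ + #bothNew (u ∷ v ∷ s) σ

  Loopless : List Edge → Set
  Loopless = All (λ e → (proj₁ e ≡ᵇ proj₂ e) ≡ false)

  length-buildFrom : ∀ s u v σ → length (buildFrom s ((u , v) ∷ σ)) ≡ ⟦ not (u ∈ᵇ s) ∨ not (v ∈ᵇ s) ⟧ + length (buildFrom (u ∷ v ∷ s) σ)
  length-buildFrom s u v σ = length-if (not (u ∈ᵇ s) ∨ not (v ∈ᵇ s))
    where
    length-if : ∀ c → length (if c then (u , v) ∷ buildFrom (u ∷ v ∷ s) σ else buildFrom (u ∷ v ∷ s) σ) ≡ ⟦ c ⟧ + length (buildFrom (u ∷ v ∷ s) σ)
    length-if true = refl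
    length-if false = refl

  ⟦∨⟧+⟦∧⟧ : ∀ a b → ⟦ a ∨ b ⟧ + ⟦ a ∧ b ⟧ ≡ ⟦ a ⟧ + ⟦ b ⟧
  ⟦∨⟧+⟦∧⟧ true true = refl
  ⟦∨⟧+⟦∧⟧ true false = refl
  ⟦∨⟧+⟦∧⟧ false true = refl
  ⟦∨⟧+⟦∧⟧ false false = refl

  -- An edge brings two new vertices iff it is both-new, one iff it is kept
  -- but not both-new; so kept edges plus both-new edges count new vertices.
  kept+bothNew : (s : List ℕ) (σ : List Edge) → Loopless σ → length (buildFrom s σ) + #bothNew s σ ≡ #new s (endpoints σ)
  kept+bothNew s [] _ = refl
  kept+bothNew s ((u , v) ∷ σ) (ne ∷ nes) = begin
    length (buildFrom s ((u , v) ∷ σ)) + (⟦ a ∧ b ⟧ + #bothNew (u ∷ v ∷ s) σ)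
      ≡⟨ cong (_+ (⟦ a ∧ b ⟧ + #bothNew (u ∷ v ∷ s) σ)) (length-buildFrom s u v σ) ⟩
    ⟦ a ∨ b ⟧ + length (buildFrom (u ∷ v ∷ s) σ) + (⟦ a ∧ b ⟧ + #bothNew (u ∷ v ∷ s) σ)
      ≡⟨ interchange ⟦ a ∨ b ⟧ (length (buildFrom (u ∷ v ∷ s) σ)) ⟦ a ∧ b ⟧ (#bothNew (u ∷ v ∷ s) σ) ⟩
    (⟦ a ∨ b ⟧ + ⟦ a ∧ b ⟧) + (length (buildFrom (u ∷ v ∷ s) σ) + #bothNew (u ∷ v ∷ s) σ)
      ≡⟨ cong₂ _+_ (⟦∨⟧+⟦∧⟧ a b) (kept+bothNew (u ∷ v ∷ s) σ nes) ⟩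
    (⟦ a ⟧ + ⟦ b ⟧) + #new (u ∷ v ∷ s) (endpoints σ)
      ≡⟨ +-assoc ⟦ a ⟧ ⟦ b ⟧ _ ⟩
    ⟦ a ⟧ + (⟦ b ⟧ + #new (u ∷ v ∷ s) (endpoints σ))
      ≡⟨ cong₂ (λ t weaken → ⟦ a ⟧ + (⟦ t ⟧ + weaken)) v-fresh (#new-cong (endpoints σ) (u ∷ v ∷ s) (v ∷ u ∷ s) seen-swap) ⟩
    ⟦ a ⟧ + (⟦ fresh (u ∷ s) v ⟧ + #new (v ∷ u ∷ s) (endpoints σ)) ∎
    where
    a = fresh s u
    b = fresh s v
    interchange : ∀ p q r t → p + q + (r + t) ≡ (p + r) + (q + t)
    interchange = solve-∀
    v-fresh : b ≡ fresh (u ∷ s) v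
    v-fresh = cong (λ t → not (t ∨ (v ∈ᵇ s))) (sym (trans (≡ᵇ-sym v u) ne))
    seen-swap : ∀ z → z ∈ᵇ (u ∷ v ∷ s) ≡ z ∈ᵇ (v ∷ u ∷ s)
    seen-swap z = trans (sym (∨-assoc (z ≡ᵇ u) (z ≡ᵇ v) _)) (trans (cong (_∨ (z ∈ᵇ s)) (∨-comm (z ≡ᵇ u) (z ≡ᵇ v))) (∨-assoc (z ≡ᵇ v) (z ≡ᵇ u) _))

  #blocksWith : ℕ → List (List ℕ) → ℕ
  #blocksWith x bs = Σ[ bs ] (λ B → ⟦ x ∈ᵇ B ⟧)

  record PartitionInv (V : List ℕ) (bs : List (List ℕ)) (s : List ℕ) : Set where
    field
      covers : ∀ x → #blocksWith x bs ≡ ⟦ x ∈ᵇ V ⟧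
      fresh-singleton : ∀ x → x ∈ᵇ V ≡ true → x ∈ᵇ s ≡ false → All (λ B → x ∈ᵇ B ≡ true → B ≡ x ∷ []) bs

  EdgesIn : List ℕ → List Edge → Set
  EdgesIn V = All (λ e → (proj₁ e ∈ᵇ V ≡ true) × (proj₂ e ∈ᵇ V ≡ true) × ((proj₁ e ≡ᵇ proj₂ e) ≡ false))

  meets : ℕ → ℕ → List ℕ → Bool
  meets u v B = (u ∈ᵇ B) ∨ (v ∈ᵇ B)

  ∈-++ : ∀ x (A B : List ℕ) → x ∈ᵇ (A ++ B) ≡ (x ∈ᵇ A) ∨ (x ∈ᵇ B)
  ∈-++ x [] B = refl
  ∈-++ x (a ∷ A) B = trans (cong ((x ≡ᵇ a) ∨_) (∈-++ x A B)) (sym (∨-assoc (x ≡ᵇ a) _ _))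

  ∈-concat : ∀ x (L : List (List ℕ)) → x ∈ᵇ concat L ≡ any (x ∈ᵇ_) L
  ∈-concat x [] = refl
  ∈-concat x (B ∷ L) = trans (∈-++ x B (concat L)) (cong ((x ∈ᵇ B) ∨_) (∈-concat x L))

  no-block-with-both : (f g : ℕ) → (g ≡ᵇ f) ≡ false → (bs : List (List ℕ)) → All (λ B → f ∈ᵇ B ≡ true → B ≡ f ∷ []) bs →
    Σ[ bs ] (λ B → ⟦ (f ∈ᵇ B) ∧ (g ∈ᵇ B) ⟧) ≡ 0
  no-block-with-both f g gf [] _ = refl
  no-block-with-both f g gf (B ∷ bs) (h ∷ hs) with f ∈ᵇ B in e
  ... | false = no-block-with-both f g gf bs hs
  ... | true rewrite h refl = trans (cong (λ t → ⟦ t ∨ false ⟧ + Σ[ bs ] (λ B → ⟦ (f ∈ᵇ B) ∧ (g ∈ᵇ B) ⟧)) gf) (no-block-with-both f g gf bs hs)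


  ≤1-summand : ∀ m n b → m + n ≡ ⟦ b ⟧ → (m ≡ 0) ⊎ (m ≡ 1)
  ≤1-summand zero n b e = inj₁ refl
  ≤1-summand (suc zero) n b e = inj₂ refl
  ≤1-summand (suc (suc m)) n true ()
  ≤1-summand (suc (suc m)) n false ()

  addEdge-length : ∀ V bs s u v → PartitionInv V bs s → u ∈ᵇ V ≡ true → v ∈ᵇ V ≡ true → (u ≡ᵇ v) ≡ false →
    (u ∈ᵇ s ≡ false) ⊎ (v ∈ᵇ s ≡ false) → suc (length (addEdge (u , v) bs)) ≡ length bs
  addEdge-length V bs s u v inv uV vV uv fr = begin
    suc (suc (length (filterᵇ (λ B → not (meets u v B)) bs)))
      ≡⟨ cong (λ t → 2 + t) (length-filter-as-Σ (λ B → not (meets u v B)) bs) ⟩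
    2 + Σ[ bs ] (λ B → ⟦ not (meets u v B) ⟧) ≡⟨ cong (_+ Σ[ bs ] (λ B → ⟦ not (meets u v B) ⟧)) (sym two) ⟩
    Σ[ bs ] (λ B → ⟦ meets u v B ⟧) + Σ[ bs ] (λ B → ⟦ not (meets u v B) ⟧) ≡⟨ sym (Σ-+ bs _ _) ⟩
    Σ[ bs ] (λ B → ⟦ meets u v B ⟧ + ⟦ not (meets u v B) ⟧) ≡⟨ Σ-cong bs (λ B → one (meets u v B)) ⟩
    Σ[ bs ] (λ _ → 1) ≡⟨ sym (length-as-Σ bs) ⟩
    length bs ∎
    where
    open PartitionInv inv
    one : ∀ b → ⟦ b ⟧ + ⟦ not b ⟧ ≡ 1
    one true = refl
    one false = refl
    no-shared-block : (u ∈ᵇ s ≡ false) ⊎ (v ∈ᵇ s ≡ false) → Σ[ bs ] (λ B → ⟦ (u ∈ᵇ B) ∧ (v ∈ᵇ B) ⟧) ≡ 0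
    no-shared-block (inj₁ us) = no-block-with-both u v (trans (≡ᵇ-sym v u) uv) bs (fresh-singleton u uV us)
    no-shared-block (inj₂ vs) = trans (Σ-cong bs (λ B → cong ⟦_⟧ (∧-comm (u ∈ᵇ B) (v ∈ᵇ B)))) (no-block-with-both v u uv bs (fresh-singleton v vV vs))
    two : Σ[ bs ] (λ B → ⟦ meets u v B ⟧) ≡ 2
    two = begin
      Σ[ bs ] (λ B → ⟦ meets u v B ⟧) ≡⟨ sym (+-identityʳ _) ⟩
      Σ[ bs ] (λ B → ⟦ meets u v B ⟧) + 0 ≡⟨ cong (Σ[ bs ] (λ B → ⟦ meets u v B ⟧) +_) (sym (no-shared-block fr)) ⟩
      Σ[ bs ] (λ B → ⟦ meets u v B ⟧) + Σ[ bs ] (λ B → ⟦ (u ∈ᵇ B) ∧ (v ∈ᵇ B) ⟧) ≡⟨ sym (Σ-+ bs _ _) ⟩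
      Σ[ bs ] (λ B → ⟦ meets u v B ⟧ + ⟦ (u ∈ᵇ B) ∧ (v ∈ᵇ B) ⟧) ≡⟨ Σ-cong bs (λ B → ⟦∨⟧+⟦∧⟧ (u ∈ᵇ B) (v ∈ᵇ B)) ⟩
      Σ[ bs ] (λ B → ⟦ u ∈ᵇ B ⟧ + ⟦ v ∈ᵇ B ⟧) ≡⟨ Σ-+ bs _ _ ⟩
      #blocksWith u bs + #blocksWith v bs ≡⟨ cong₂ _+_ (trans (covers u) (cong ⟦_⟧ uV)) (trans (covers v) (cong ⟦_⟧ vV)) ⟩
      2 ∎

  addEdge-inv : ∀ V bs s u v → PartitionInv V bs s → PartitionInv V (addEdge (u , v) bs) (u ∷ v ∷ s)
  addEdge-inv V bs s u v inv = record { covers = merged-covers ; fresh-singleton = merged-singletons }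
    where
    open PartitionInv inv
    F1 = filterᵇ (meets u v) bs
    F2 = filterᵇ (λ B → not (meets u v B)) bs
    merged-covers : ∀ x → #blocksWith x (addEdge (u , v) bs) ≡ ⟦ x ∈ᵇ V ⟧
    merged-covers x with ≤1-summand (#blocksWith x F1) (#blocksWith x F2) (x ∈ᵇ V) (trans (Σ-filter-split (meets u v) (λ B → ⟦ x ∈ᵇ B ⟧) bs) (covers x))
    ... | inj₁ z = begin
      ⟦ x ∈ᵇ concat F1 ⟧ + #blocksWith x F2 ≡⟨ cong (λ t → ⟦ t ⟧ + #blocksWith x F2) (trans (∈-concat x F1) (any-0 (x ∈ᵇ_) F1 z)) ⟩
      #blocksWith x F2 ≡⟨ cong (_+ #blocksWith x F2) (sym z) ⟩
      #blocksWith x F1 + #blocksWith x F2 ≡⟨ Σ-filter-split (meets u v) (λ B → ⟦ x ∈ᵇ B ⟧) bs ⟩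
      #blocksWith x bs ≡⟨ covers x ⟩ ⟦ x ∈ᵇ V ⟧ ∎
    ... | inj₂ o = begin
      ⟦ x ∈ᵇ concat F1 ⟧ + #blocksWith x F2 ≡⟨ cong (λ t → ⟦ t ⟧ + #blocksWith x F2) (trans (∈-concat x F1) (any-1 (x ∈ᵇ_) F1 o)) ⟩
      1 + #blocksWith x F2 ≡⟨ cong (_+ #blocksWith x F2) (sym o) ⟩
      #blocksWith x F1 + #blocksWith x F2 ≡⟨ Σ-filter-split (meets u v) (λ B → ⟦ x ∈ᵇ B ⟧) bs ⟩
      #blocksWith x bs ≡⟨ covers x ⟩ ⟦ x ∈ᵇ V ⟧ ∎
    -- an unseen x ≠ u, v is in no merged block, so keeps its singleton
    merged-singletons : ∀ x → x ∈ᵇ V ≡ true → x ∈ᵇ (u ∷ v ∷ s) ≡ false → All (λ B → x ∈ᵇ B ≡ true → B ≡ x ∷ []) (addEdge (u , v) bs)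
    merged-singletons x xV xs = (λ h → true≢false (trans (sym h) not-merged)) ∷ All.map proj₁ (All-filter (λ B → not (meets u v B)) singletons)
      where
      xu : (x ≡ᵇ u) ≡ false
      xu = ∨-false-l xs
      xv : (x ≡ᵇ v) ≡ false
      xv = ∨-false-l (∨-false-r {x ≡ᵇ u} xs)
      xs' : x ∈ᵇ s ≡ false
      xs' = ∨-false-r {x ≡ᵇ v} (∨-false-r {x ≡ᵇ u} xs)
      singletons = fresh-singleton x xV xs'
      x-meets-not : meets u v (x ∷ []) ≡ false
      x-meets-not = cong₂ _∨_ (cong (_∨ false) (trans (≡ᵇ-sym u x) xu)) (cong (_∨ false) (trans (≡ᵇ-sym v x) xv))
      not-in-merged : ∀ B → (x ∈ᵇ B ≡ true → B ≡ x ∷ []) × (meets u v B ≡ true) → x ∈ᵇ B ≡ false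
      not-in-merged B (h , m) with x ∈ᵇ B in e
      ... | false = refl
      ... | true = true≢false (trans (sym m) (trans (cong (meets u v) (h refl)) x-meets-not))
      not-merged : x ∈ᵇ concat F1 ≡ false
      not-merged = trans (∈-concat x F1) (any-false (x ∈ᵇ_) (All.map (λ {B} → not-in-merged B) (All-filter (meets u v) singletons)))

  -- Each kept edge reduces the number of blocks by one.
  components+kept : (V : List ℕ) (σ : List Edge) (bs : List (List ℕ)) (s : List ℕ) → PartitionInv V bs s → EdgesIn V σ →
    length (componentsFrom bs (buildFrom s σ)) + length (buildFrom s σ) ≡ length bs
  components+kept V [] bs s inv ok = +-identityʳ _
  components+kept V ((u , v) ∷ σ) bs s inv ((uV , vV , uv) ∷ ok) = step (not (u ∈ᵇ s) ∨ not (v ∈ᵇ s)) refl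
    where
    open PartitionInv inv
    B' = buildFrom (u ∷ v ∷ s) σ
    oneUnseen : ∀ a b → (not a ∨ not b) ≡ true → (a ≡ false) ⊎ (b ≡ false)
    oneUnseen false b e = inj₁ refl
    oneUnseen true false e = inj₂ refl
    inv' : PartitionInv V bs (u ∷ v ∷ s)
    inv' = record { covers = covers ; fresh-singleton = λ x xV xs → fresh-singleton x xV (∨-false-r {x ≡ᵇ v} (∨-false-r {x ≡ᵇ u} xs)) }
    step : (c : Bool) → (not (u ∈ᵇ s) ∨ not (v ∈ᵇ s)) ≡ c →
      length (componentsFrom bs (if c then (u , v) ∷ B' else B')) + length (if c then (u , v) ∷ B' else B') ≡ length bs
    step true k = trans (+-suc _ _) (trans (cong suc (components+kept V σ (addEdge (u , v) bs) (u ∷ v ∷ s) (addEdge-inv V bs s u v inv) ok))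
      (addEdge-length V bs s u v inv uV vV uv (oneUnseen (u ∈ᵇ s) (v ∈ᵇ s) k)))
    step false k = components+kept V σ bs (u ∷ v ∷ s) inv' ok

  #occ-filter : (x : ℕ) (p : ℕ → Bool) (D : List ℕ) → #occ x (filterᵇ p D) ≡ ⟦ p x ⟧ * #occ x D
  #occ-filter x p [] = sym (Data.Nat.Properties.*-zeroʳ ⟦ p x ⟧)
  #occ-filter x p (d ∷ D) = by-cases (p d) (x ≡ᵇ d) refl refl
    where
    IH = #occ-filter x p D
    by-cases : (b c : Bool) → p d ≡ b → (x ≡ᵇ d) ≡ c → #occ x (filterᵇ p (d ∷ D)) ≡ ⟦ p x ⟧ * #occ x (d ∷ D)
    by-cases true true pd xd = begin
      #occ x (filterᵇ p (d ∷ D)) ≡⟨ cong (#occ x) (filter-accept p D pd) ⟩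
      ⟦ x ≡ᵇ d ⟧ + #occ x (filterᵇ p D) ≡⟨ cong₂ (λ c n → ⟦ c ⟧ + n) xd IH ⟩
      1 + ⟦ p x ⟧ * #occ x D ≡⟨ cong (λ b → 1 + ⟦ b ⟧ * #occ x D) px ⟩
      1 * (1 + #occ x D) ≡⟨ cong₂ (λ b c → ⟦ b ⟧ * (⟦ c ⟧ + #occ x D)) (sym px) (sym xd) ⟩
      ⟦ p x ⟧ * #occ x (d ∷ D) ∎
      where
      px : p x ≡ true
      px = trans (cong p (≡ᵇ-sound x d xd)) pd
    by-cases true false pd xd = trans (cong (#occ x) (filter-accept p D pd))
      (trans (cong₂ (λ c n → ⟦ c ⟧ + n) xd IH) (cong (λ c → ⟦ p x ⟧ * (⟦ c ⟧ + #occ x D)) (sym xd)))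
    by-cases false true pd xd = begin
      #occ x (filterᵇ p (d ∷ D)) ≡⟨ cong (#occ x) (filter-reject p D pd) ⟩
      #occ x (filterᵇ p D) ≡⟨ IH ⟩
      ⟦ p x ⟧ * #occ x D ≡⟨ cong (λ b → ⟦ b ⟧ * #occ x D) px ⟩
      0 ≡⟨ cong (λ b → ⟦ b ⟧ * #occ x (d ∷ D)) (sym px) ⟩
      ⟦ p x ⟧ * #occ x (d ∷ D) ∎
      where
      px : p x ≡ false
      px = trans (cong p (≡ᵇ-sound x d xd)) pd
    by-cases false false pd xd = trans (cong (#occ x) (filter-reject p D pd))
      (trans IH (cong (λ c → ⟦ p x ⟧ * (⟦ c ⟧ + #occ x D)) (sym xd)))

  ∈-filter : (x : ℕ) (p : ℕ → Bool) (D : List ℕ) → x ∈ᵇ filterᵇ p D ≡ (p x ∧ (x ∈ᵇ D))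
  ∈-filter x p [] = sym (Data.Bool.Properties.∧-zeroʳ (p x))
  ∈-filter x p (d ∷ D) = by-cases (p d) (x ≡ᵇ d) refl refl
    where
    IH = ∈-filter x p D
    by-cases : (b c : Bool) → p d ≡ b → (x ≡ᵇ d) ≡ c → x ∈ᵇ filterᵇ p (d ∷ D) ≡ (p x ∧ (x ∈ᵇ (d ∷ D)))
    by-cases true true pd xd = begin
      x ∈ᵇ filterᵇ p (d ∷ D) ≡⟨ cong (x ∈ᵇ_) (filter-accept p D pd) ⟩
      (x ≡ᵇ d) ∨ (x ∈ᵇ filterᵇ p D) ≡⟨ cong (_∨ (x ∈ᵇ filterᵇ p D)) xd ⟩
      true ≡⟨ cong₂ (λ b c → b ∧ (c ∨ (x ∈ᵇ D))) (sym px) (sym xd) ⟩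
      p x ∧ ((x ≡ᵇ d) ∨ (x ∈ᵇ D)) ∎
      where
      px : p x ≡ true
      px = trans (cong p (≡ᵇ-sound x d xd)) pd
    by-cases true false pd xd = trans (cong (x ∈ᵇ_) (filter-accept p D pd))
      (trans (cong₂ _∨_ xd IH) (cong (λ c → p x ∧ (c ∨ (x ∈ᵇ D))) (sym xd)))
    by-cases false true pd xd = begin
      x ∈ᵇ filterᵇ p (d ∷ D) ≡⟨ cong (x ∈ᵇ_) (filter-reject p D pd) ⟩
      x ∈ᵇ filterᵇ p D ≡⟨ IH ⟩
      p x ∧ (x ∈ᵇ D) ≡⟨ cong (_∧ (x ∈ᵇ D)) px ⟩
      false ≡⟨ cong (_∧ ((x ≡ᵇ d) ∨ (x ∈ᵇ D))) (sym px) ⟩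
      p x ∧ ((x ≡ᵇ d) ∨ (x ∈ᵇ D)) ∎
      where
      px : p x ≡ false
      px = trans (cong p (≡ᵇ-sound x d xd)) pd
    by-cases false false pd xd = trans (cong (x ∈ᵇ_) (filter-reject p D pd))
      (trans IH (cong (λ c → p x ∧ (c ∨ (x ∈ᵇ D))) (sym xd)))

  #occ-dedup : (x : ℕ) (xs : List ℕ) → #occ x (deduplicateᵇ _≡ᵇ_ xs) ≡ ⟦ x ∈ᵇ xs ⟧
  #occ-dedup x [] = refl
  #occ-dedup x (y ∷ ys) = begin
    #occ x (deduplicateᵇ _≡ᵇ_ (y ∷ ys)) ≡⟨ cong (#occ x) (dedup-cons y ys) ⟩
    ⟦ x ≡ᵇ y ⟧ + #occ x (filterᵇ (λ z → not (y ≡ᵇ z)) D) ≡⟨ cong (⟦ x ≡ᵇ y ⟧ +_) (#occ-filter x (λ z → not (y ≡ᵇ z)) D) ⟩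
    ⟦ x ≡ᵇ y ⟧ + ⟦ not (y ≡ᵇ x) ⟧ * #occ x D ≡⟨ cong (λ b → ⟦ x ≡ᵇ y ⟧ + ⟦ not b ⟧ * #occ x D) (≡ᵇ-sym y x) ⟩
    ⟦ x ≡ᵇ y ⟧ + ⟦ not (x ≡ᵇ y) ⟧ * #occ x D ≡⟨ combine (x ≡ᵇ y) (#occ x D) (x ∈ᵇ ys) (#occ-dedup x ys) ⟩
    ⟦ x ∈ᵇ (y ∷ ys) ⟧ ∎
    where
    D = deduplicateᵇ _≡ᵇ_ ys
    combine : ∀ c n m → n ≡ ⟦ m ⟧ → ⟦ c ⟧ + ⟦ not c ⟧ * n ≡ ⟦ c ∨ m ⟧
    combine true n m e = refl
    combine false n m e = trans (+-identityʳ n) e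

  ∈-dedup : (x : ℕ) (xs : List ℕ) → x ∈ᵇ deduplicateᵇ _≡ᵇ_ xs ≡ x ∈ᵇ xs
  ∈-dedup x [] = refl
  ∈-dedup x (y ∷ ys) = begin
    x ∈ᵇ deduplicateᵇ _≡ᵇ_ (y ∷ ys) ≡⟨ cong (x ∈ᵇ_) (dedup-cons y ys) ⟩
    (x ≡ᵇ y) ∨ (x ∈ᵇ filterᵇ (λ z → not (y ≡ᵇ z)) D) ≡⟨ cong ((x ≡ᵇ y) ∨_) (∈-filter x (λ z → not (y ≡ᵇ z)) D) ⟩
    (x ≡ᵇ y) ∨ (not (y ≡ᵇ x) ∧ (x ∈ᵇ D)) ≡⟨ cong₂ (λ b c → (x ≡ᵇ y) ∨ (not b ∧ c)) (≡ᵇ-sym y x) (∈-dedup x ys) ⟩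
    (x ≡ᵇ y) ∨ (not (x ≡ᵇ y) ∧ (x ∈ᵇ ys)) ≡⟨ combine (x ≡ᵇ y) (x ∈ᵇ ys) ⟩
    x ∈ᵇ (y ∷ ys) ∎
    where
    D = deduplicateᵇ _≡ᵇ_ ys
    combine : ∀ c m → c ∨ (not c ∧ m) ≡ c ∨ m
    combine true m = refl
    combine false m = refl

  endpoints-in : (G : List Edge) → All (λ e → (proj₁ e ∈ᵇ endpoints G ≡ true) × (proj₂ e ∈ᵇ endpoints G ≡ true)) G
  endpoints-in [] = []
  endpoints-in ((a , b) ∷ G) = (cong (_∨ (a ∈ᵇ (b ∷ endpoints G))) (≡ᵇ-refl a) , ∨-true-r (b ≡ᵇ a) (cong (_∨ (b ∈ᵇ endpoints G)) (≡ᵇ-refl b)))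
    ∷ All.map (λ {e} h → (weaken {proj₁ e} (proj₁ h) , weaken {proj₂ e} (proj₂ h))) (endpoints-in G)
    where
    weaken : ∀ {x} → x ∈ᵇ endpoints G ≡ true → x ∈ᵇ (a ∷ b ∷ endpoints G) ≡ true
    weaken {x} h = ∨-true-r (x ≡ᵇ a) (∨-true-r (x ≡ᵇ b) h)

  singletons-inv : (G : List Edge) → PartitionInv (vertices G) (map (λ x → x ∷ []) (vertices G)) []
  singletons-inv G = record
    { covers = λ x → trans (Σ-map V (λ B → ⟦ x ∈ᵇ B ⟧) (λ x → x ∷ []))
                 (trans (Σ-cong V (λ y → cong ⟦_⟧ (∨-identityʳ (x ≡ᵇ y))))
                 (trans (#occ-dedup x (endpoints G)) (cong ⟦_⟧ (sym (∈-dedup x (endpoints G))))))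
    ; fresh-singleton = λ x _ _ → map⁺ (allList (λ y h → cong (_∷ []) (sym (≡ᵇ-sound x y (trans (sym (∨-identityʳ _)) h)))) V) }
    where
    V = vertices G

  edges-in-vertices : (G : List Edge) → Loopless G → EdgesIn (vertices G) G
  edges-in-vertices G = zipAll (endpoints-in G)
    where
    zipAll : {L : List Edge} → All (λ e → (proj₁ e ∈ᵇ endpoints G ≡ true) × (proj₂ e ∈ᵇ endpoints G ≡ true)) L →
      Loopless L → EdgesIn (vertices G) L
    zipAll [] [] = []
    zipAll {e ∷ _} ((h₁ , h₂) ∷ hs) (n ∷ ns) =
      (trans (∈-dedup (proj₁ e) (endpoints G)) h₁ , trans (∈-dedup (proj₂ e) (endpoints G)) h₂ , n) ∷ zipAll hs ns

  -- Trees = both-new edges: blocks + kept = |V| = kept + both-new.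
  numTrees≡#bothNew : (G σ : List Edge) → σ ↭ G → Loopless G → numTrees G σ ≡ #bothNew [] σ
  numTrees≡#bothNew G σ p loopless =
    +-cancelʳ-≡ (length (forest σ)) _ (#bothNew [] σ) (trans count-V (+-comm (length (forest σ)) (#bothNew [] σ)))
    where
    V = vertices G
    count-V : length (componentsFrom (map (λ x → x ∷ []) V) (forest σ)) + length (forest σ) ≡ length (forest σ) + #bothNew [] σ
    count-V = begin
      length (componentsFrom (map (λ x → x ∷ []) V) (forest σ)) + length (forest σ)
        ≡⟨ components+kept V σ _ [] (singletons-inv G) (All-resp-↭ (↭-sym p) (edges-in-vertices G loopless)) ⟩
      length (map (λ x → x ∷ []) V)       ≡⟨ length-map (λ x → x ∷ []) V ⟩
      length V                            ≡⟨ length-dedup (endpoints G) ⟩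
      #new [] (endpoints G)               ≡⟨ #new-↭ (endpoints-↭ (↭-sym p)) [] ⟩
      #new [] (endpoints σ)               ≡⟨ sym (kept+bothNew [] σ (All-resp-↭ (↭-sym p) loopless)) ⟩
      length (forest σ) + #bothNew [] σ   ∎

module CentreScan where

  open import Data.Bool using (Bool; true; false; not; _∨_; _∧_; if_then_else_)
  open import Data.Bool.Properties using (∧-zeroʳ)
  open import Data.Nat using (ℕ; zero; suc; _+_; _*_; _≡ᵇ_; _≤_; s≤s)
  open import Data.Nat.Properties using (+-assoc; +-identityʳ; *-zeroʳ; m+n≡0⇒m≡0)
  open import Data.List using (List; []; _∷_; length; filterᵇ)
  open import Data.Bool.ListAction using (any)
  open import Data.List.Relation.Unary.All as All using (All; []; _∷_)
  open import Data.Product using (_×_; _,_; proj₁; proj₂)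
  open import Data.Sum using (_⊎_; inj₁; inj₂)
  open import Relation.Binary.PropositionalEquality using (_≡_; _≢_; refl; sym; trans; cong; cong₂)
  open import Data.Nat.Tactic.RingSolver using (solve-∀)
  open import Defs
  open ListSums
  open Orderings
  open FirstElements
  open Equality
  open ForestTrees

  open Relation.Binary.PropositionalEquality.≡-Reasoning

  -- Vocabulary for glued stars: the centres are u = 0 and w = 1, every
  -- other vertex q ≥ 2 is a leaf.

  uw : Edge
  uw = (0 , 1)

  touches : ℕ → Edge → Bool
  touches z e = (proj₁ e ≡ᵇ z) ∨ (proj₂ e ≡ᵇ z)

  spoke : ℕ → ℕ → Edge → Bool
  spoke z z' e = (proj₁ e ≡ᵇ z) ∧ not (proj₂ e ≡ᵇ z')

  #bothNewAmong : (Edge → Bool) → List ℕ → List Edge → ℕ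
  #bothNewAmong f s [] = 0
  #bothNewAmong f s ((u , v) ∷ σ) =
    (if f (u , v) then ⟦ fresh s u ∧ fresh s v ⟧ else 0) + #bothNewAmong f (u ∷ v ∷ s) σ

  -- joinsVia z z' y flag σ = 1 iff the first edge of σ at z is (z, y) and
  -- (z', y) comes before it (or flag already records that it came).
  joinsVia : ℕ → ℕ → ℕ → Bool → List Edge → ℕ
  joinsVia z z' y flag [] = 0
  joinsVia z z' y flag (e ∷ σ) =
    if eqE e (z' , y) then joinsVia z z' y true σ
    else (if touches z e then ⟦ flag ∧ eqE e (z , y) ⟧ else joinsVia z z' y flag σ)

  data GSEdge : Edge → Set where
    uw-edge : GSEdge (0 , 1)
    u-edge : ∀ q → 2 ≤ q → GSEdge (0 , q)
    w-edge : ∀ q → 2 ≤ q → GSEdge (1 , q)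

  data Centres : ℕ → ℕ → Set where
    u,w : Centres 0 1
    w,u : Centres 1 0

  data CentreEdge (z z' : ℕ) : Edge → Set where
    uw-edge : CentreEdge z z' (0 , 1)
    near-edge : ∀ q → 2 ≤ q → CentreEdge z z' (z , q)
    far-edge : ∀ q → 2 ≤ q → CentreEdge z z' (z' , q)

  asCentreEdge : ∀ {z z' e} → Centres z z' → GSEdge e → CentreEdge z z' e
  asCentreEdge u,w uw-edge = uw-edge
  asCentreEdge u,w (u-edge q h) = near-edge q h
  asCentreEdge u,w (w-edge q h) = far-edge q h
  asCentreEdge w,u uw-edge = uw-edge
  asCentreEdge w,u (u-edge q h) = far-edge q h
  asCentreEdge w,u (w-edge q h) = near-edge q h

  leaf≢0 : ∀ {q} → 2 ≤ q → (q ≡ᵇ 0) ≡ false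
  leaf≢0 (s≤s (s≤s _)) = refl

  leaf≢1 : ∀ {q} → 2 ≤ q → (q ≡ᵇ 1) ≡ false
  leaf≢1 (s≤s (s≤s _)) = refl

  module _ {z z' : ℕ} where

    near≢far : Centres z z' → (z ≡ᵇ z') ≡ false
    near≢far u,w = refl
    near≢far w,u = refl

    far≢near : Centres z z' → (z' ≡ᵇ z) ≡ false
    far≢near u,w = refl
    far≢near w,u = refl

    leaf≢near : Centres z z' → ∀ {q} → 2 ≤ q → (q ≡ᵇ z) ≡ false
    leaf≢near u,w = leaf≢0
    leaf≢near w,u = leaf≢1

    leaf≢far : Centres z z' → ∀ {q} → 2 ≤ q → (q ≡ᵇ z') ≡ false
    leaf≢far u,w = leaf≢1
    leaf≢far w,u = leaf≢0

    uw-touches : Centres z z' → touches z uw ≡ true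
    uw-touches u,w = refl
    uw-touches w,u = refl

    uw-not-spoke : Centres z z' → spoke z z' uw ≡ false
    uw-not-spoke u,w = refl
    uw-not-spoke w,u = refl

    uw-reveals : Centres z z' → ∀ s → z ∈ᵇ (0 ∷ 1 ∷ s) ≡ true
    uw-reveals u,w s = refl
    uw-reveals w,u s = refl

  ≢0-+ˡ : ∀ m {n} → n ≢ 0 → m + n ≢ 0
  ≢0-+ˡ zero h = h
  ≢0-+ˡ (suc m) h ()

  count-head≢0 : ∀ x σ → count x (x ∷ σ) ≢ 0
  count-head≢0 x σ e with () ← trans (sym (cong ⟦_⟧ (eqE-refl x))) (m+n≡0⇒m≡0 _ e)

  uw≢leaf-edge : ∀ p {y} → 2 ≤ y → eqE uw (p , y) ≡ false
  uw≢leaf-edge p {y} h = trans (eqE-pair 0 1 p y) (trans (cong ((0 ≡ᵇ p) ∧_) (trans (≡ᵇ-sym 1 y) (leaf≢1 h))) (∧-zeroʳ (0 ≡ᵇ p)))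

  bothNew-spokes-seen : (z z' : ℕ) (s : List ℕ) (σ : List Edge) → z ∈ᵇ s ≡ true → #bothNewAmong (spoke z z') s σ ≡ 0
  bothNew-spokes-seen z z' s [] h = refl
  bothNew-spokes-seen z z' s ((u , v) ∷ σ) h =
    cong₂ _+_ (head (u ≡ᵇ z) refl) (bothNew-spokes-seen z z' (u ∷ v ∷ s) σ (∨-true-r (z ≡ᵇ u) (∨-true-r (z ≡ᵇ v) h)))
    where
    head : ∀ b → (u ≡ᵇ z) ≡ b → (if (u ≡ᵇ z) ∧ not (v ≡ᵇ z') then ⟦ fresh s u ∧ fresh s v ⟧ else 0) ≡ 0
    head false e rewrite e = refl
    head true e rewrite ≡ᵇ-sound u z e | h with (z ≡ᵇ z) ∧ not (v ≡ᵇ z')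
    ... | true = refl
    ... | false = refl

  bothNew-none : (f : Edge → Bool) (s : List ℕ) (σ : List Edge) → All (λ e → f e ≡ false) σ → #bothNewAmong f s σ ≡ 0
  bothNew-none f s [] _ = refl
  bothNew-none f s ((u , v) ∷ σ) (h ∷ hs) rewrite h = bothNew-none f (u ∷ v ∷ s) σ hs

  -- The view from one centre z, for a list Y of middle vertices (the leaves
  -- adjacent to both centres).  Scanning σ, the first edge at z is either
  -- uw, or a spoke (z, q) with q new (a both-new spoke), or a spoke (z, y)
  -- with y already seen, which happens only through (z', y), so y ∈ Y.
  module FirstEdgeAt (z z' : ℕ) (P : Centres z z') (Y : List ℕ) (Y≥2 : All (2 ≤_) Y) where

    side : List ℕ → List Edge → ℕ
    side s σ = #bothNewAmong (spoke z z') s σ + startsWith uw (filterᵇ (touches z) σ)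
      + Σ[ Y ] (λ y → joinsVia z z' y (y ∈ᵇ s) σ)

    SeenMiddle : List ℕ → List Edge → Set
    SeenMiddle s σ = ∀ q → 2 ≤ q → q ∈ᵇ s ≡ true → count (z , q) σ ≢ 0 → #occ q Y ≡ 1

    SharedMiddle : List Edge → Set
    SharedMiddle σ = ∀ q → 2 ≤ q → count (z' , q) σ ≢ 0 → count (z , q) σ ≢ 0 → #occ q Y ≡ 1

    Σ-middle-zero : (f : ℕ → ℕ) → (∀ {y} → 2 ≤ y → f y ≡ 0) → Σ[ Y ] f ≡ 0
    Σ-middle-zero f h = trans (Σ-congAll (All.map h Y≥2)) (Σ-zero Y (λ _ → refl))

    first-uw : (s : List ℕ) (σ : List Edge) → side s (uw ∷ σ) ≡ 1
    first-uw s σ = cong₂ _+_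
      (cong₂ _+_ (cong₂ _+_ (if-false (uw-not-spoke P)) (bothNew-spokes-seen z z' _ σ (uw-reveals P s)))
                 (trans (cong (startsWith uw) (filter-accept (touches z) σ (uw-touches P))) (cong ⟦_⟧ (eqE-refl uw))))
      (Σ-middle-zero _ (λ {y} h → trans (if-false (uw≢leaf-edge z' h)) (trans (if-true (uw-touches P))
        (trans (cong (λ b → ⟦ (y ∈ᵇ s) ∧ b ⟧) (uw≢leaf-edge z h)) (cong ⟦_⟧ (∧-zeroʳ (y ∈ᵇ s)))))))

    -- the first edge at z is (z, q): both-new if q is new, a join otherwise
    first-near : (s : List ℕ) (σ : List Edge) (q : ℕ) → 2 ≤ q → z ∈ᵇ s ≡ false →
      SeenMiddle s ((z , q) ∷ σ) → side s ((z , q) ∷ σ) ≡ 1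
    first-near s σ q q≥2 z-unseen seen = begin
      side s ((z , q) ∷ σ)
        ≡⟨ cong₂ _+_ (cong₂ _+_ (cong₂ _+_ (trans (if-true is-spoke) (cong (λ b → ⟦ not b ∧ fresh s q ⟧) z-unseen))
                                           (bothNew-spokes-seen z z' _ σ z-seen))
                                (trans (cong (startsWith uw) (filter-accept (touches z) σ at-z)) (cong ⟦_⟧ (uw≢leaf-edge z q≥2))))
                     (trans (Σ-congAll (All.map (λ {y} _ → join y) Y≥2)) (Σ-*ˡ Y ⟦ q ∈ᵇ s ⟧ (λ y → ⟦ q ≡ᵇ y ⟧))) ⟩
      ⟦ fresh s q ⟧ + 0 + 0 + ⟦ q ∈ᵇ s ⟧ * #occ q Y ≡⟨ new-or-seen (q ∈ᵇ s) refl ⟩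
      1 ∎
      where
      at-z : touches z (z , q) ≡ true
      at-z = cong (_∨ (q ≡ᵇ z)) (≡ᵇ-refl z)
      is-spoke : spoke z z' (z , q) ≡ true
      is-spoke = cong₂ (λ a b → a ∧ not b) (≡ᵇ-refl z) (leaf≢far P q≥2)
      z-seen : z ∈ᵇ (z ∷ q ∷ s) ≡ true
      z-seen = cong (_∨ ((z ≡ᵇ q) ∨ (z ∈ᵇ s))) (≡ᵇ-refl z)
      join : ∀ y → joinsVia z z' y (y ∈ᵇ s) ((z , q) ∷ σ) ≡ ⟦ q ∈ᵇ s ⟧ * ⟦ q ≡ᵇ y ⟧
      join y = trans (if-false (trans (eqE-pair z q z' y) (cong (_∧ (q ≡ᵇ y)) (near≢far P))))
        (trans (if-true at-z) (trans (cong (λ b → ⟦ (y ∈ᵇ s) ∧ b ⟧) (trans (eqE-pair z q z y) (cong (_∧ (q ≡ᵇ y)) (≡ᵇ-refl z))))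
        (same-leaf (q ≡ᵇ y) refl)))
        where
        same-leaf : ∀ b → (q ≡ᵇ y) ≡ b → ⟦ (y ∈ᵇ s) ∧ (q ≡ᵇ y) ⟧ ≡ ⟦ q ∈ᵇ s ⟧ * ⟦ q ≡ᵇ y ⟧
        same-leaf true e rewrite e | ≡ᵇ-sound q y e with y ∈ᵇ s
        ... | true = refl
        ... | false = refl
        same-leaf false e rewrite e = trans (cong ⟦_⟧ (∧-zeroʳ (y ∈ᵇ s))) (sym (*-zeroʳ ⟦ q ∈ᵇ s ⟧))
      new-or-seen : ∀ b → q ∈ᵇ s ≡ b → ⟦ fresh s q ⟧ + 0 + 0 + ⟦ q ∈ᵇ s ⟧ * #occ q Y ≡ 1
      new-or-seen true e rewrite e = trans (+-identityʳ (#occ q Y)) (seen q q≥2 e (count-head≢0 (z , q) σ))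
      new-or-seen false e rewrite e = refl

    far-joins : (s : List ℕ) (σ : List Edge) (q : ℕ) → 2 ≤ q → ∀ y → 2 ≤ y →
      joinsVia z z' y (y ∈ᵇ s) ((z' , q) ∷ σ) ≡ joinsVia z z' y (y ∈ᵇ (z' ∷ q ∷ s)) σ
    far-joins s σ q q≥2 y y≥2 with q ≡ᵇ y in e
    ... | true = trans (if-true (trans same-far e)) (cong (λ b → joinsVia z z' y b σ) (sym (trans y-seen (cong (_∨ (y ∈ᵇ s)) (trans (≡ᵇ-sym y q) e)))))
      where
      same-far : eqE (z' , q) (z' , y) ≡ (q ≡ᵇ y)
      same-far = trans (eqE-pair z' q z' y) (cong (_∧ (q ≡ᵇ y)) (≡ᵇ-refl z'))
      y-seen : y ∈ᵇ (z' ∷ q ∷ s) ≡ (y ≡ᵇ q) ∨ (y ∈ᵇ s)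
      y-seen = cong (_∨ ((y ≡ᵇ q) ∨ (y ∈ᵇ s))) (leaf≢far P y≥2)
    ... | false = trans (if-false (trans same-far e)) (trans (if-false (cong₂ _∨_ (far≢near P) (leaf≢near P q≥2)))
        (cong (λ b → joinsVia z z' y b σ) (sym (trans y-seen (cong (_∨ (y ∈ᵇ s)) (trans (≡ᵇ-sym y q) e))))))
      where
      same-far : eqE (z' , q) (z' , y) ≡ (q ≡ᵇ y)
      same-far = trans (eqE-pair z' q z' y) (cong (_∧ (q ≡ᵇ y)) (≡ᵇ-refl z'))
      y-seen : y ∈ᵇ (z' ∷ q ∷ s) ≡ (y ≡ᵇ q) ∨ (y ∈ᵇ s)
      y-seen = cong (_∨ ((y ≡ᵇ q) ∨ (y ∈ᵇ s))) (leaf≢far P y≥2)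

    far-seen : (s : List ℕ) (σ : List Edge) (q : ℕ) → 2 ≤ q → SeenMiddle s ((z' , q) ∷ σ) →
      SharedMiddle ((z' , q) ∷ σ) → SeenMiddle (z' ∷ q ∷ s) σ
    far-seen s σ q q≥2 seen shared q₀ q₀≥2 h nz with q₀ ≡ᵇ q in e
    ... | true rewrite ≡ᵇ-sound q₀ q e = shared q q≥2 (count-head≢0 (z' , q) σ) (≢0-+ˡ ⟦ eqE (z , q) (z' , q) ⟧ nz)
    ... | false = seen q₀ q₀≥2 (trans (sym (cong (_∨ (q₀ ∈ᵇ s)) (leaf≢far P q₀≥2))) h)
                    (≢0-+ˡ ⟦ eqE (z , q₀) (z' , q) ⟧ nz)

    side≡any : (s : List ℕ) (σ : List Edge) → z ∈ᵇ s ≡ false → All (CentreEdge z z') σ →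
      SeenMiddle s σ → SharedMiddle σ → side s σ ≡ ⟦ any (touches z) σ ⟧
    side≡any s [] _ _ _ _ = Σ-middle-zero (λ y → joinsVia z z' y (y ∈ᵇ s) []) (λ _ → refl)
    side≡any s ((0 , 1) ∷ σ) _ (uw-edge ∷ _) _ _ =
      trans (first-uw s σ) (cong (λ b → ⟦ b ∨ any (touches z) σ ⟧) (sym (uw-touches P)))
    side≡any s ((z , q) ∷ σ) z-unseen (near-edge q q≥2 ∷ _) seen _ =
      trans (first-near s σ q q≥2 z-unseen seen) (cong (λ b → ⟦ b ∨ any (touches z) σ ⟧) (sym (cong (_∨ (q ≡ᵇ z)) (≡ᵇ-refl z))))
    side≡any s ((z' , q) ∷ σ) z-unseen (far-edge q q≥2 ∷ edges) seen shared = begin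
      side s ((z' , q) ∷ σ)
        ≡⟨ cong₂ _+_ (cong₂ _+_ (cong (_+ #bothNewAmong (spoke z z') s' σ) (if-false (cong (_∧ not (q ≡ᵇ z')) (far≢near P))))
                                (cong (startsWith uw) (filter-reject (touches z) {z' , q} σ not-at-z)))
                     (Σ-congAll (All.map (λ {y} → far-joins s σ q q≥2 y) Y≥2)) ⟩
      side s' σ
        ≡⟨ side≡any s' σ z-unseen' edges (far-seen s σ q q≥2 seen shared)
             (λ q₀ q₀≥2 n₁ n₂ → shared q₀ q₀≥2 (≢0-+ˡ ⟦ eqE (z' , q₀) (z' , q) ⟧ n₁) (≢0-+ˡ ⟦ eqE (z , q₀) (z' , q) ⟧ n₂)) ⟩
      ⟦ any (touches z) σ ⟧
        ≡⟨ cong (λ b → ⟦ b ∨ any (touches z) σ ⟧) (sym not-at-z) ⟩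
      ⟦ any (touches z) ((z' , q) ∷ σ) ⟧ ∎
      where
      s' = z' ∷ q ∷ s
      not-at-z : touches z (z' , q) ≡ false
      not-at-z = cong₂ _∨_ (far≢near P) (leaf≢near P q≥2)
      z-unseen' : z ∈ᵇ s' ≡ false
      z-unseen' = cong₂ _∨_ (near≢far P) (cong₂ _∨_ (trans (≡ᵇ-sym z q) (leaf≢near P q≥2)) z-unseen)

  isUW : Edge → Bool
  isUW e = eqE e uw

  one-kind : ∀ {e} → GSEdge e → ⟦ isUW e ⟧ + ⟦ spoke 0 1 e ⟧ + ⟦ spoke 1 0 e ⟧ ≡ 1
  one-kind uw-edge = cong (λ b → ⟦ b ⟧ + 0 + 0) (eqE-refl uw)
  one-kind (u-edge q h) = cong₂ (λ b c → ⟦ b ⟧ + ⟦ not c ⟧ + 0) (trans (eqE-pair 0 q 0 1) (leaf≢1 h)) (leaf≢1 h)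
  one-kind (w-edge q h) = cong₂ (λ b c → ⟦ b ⟧ + 0 + ⟦ not c ⟧) (eqE-pair 1 q 0 1) (leaf≢0 h)

  bothNew-split : (s : List ℕ) (σ : List Edge) → All GSEdge σ →
    #bothNew s σ ≡ #bothNewAmong isUW s σ + #bothNewAmong (spoke 0 1) s σ + #bothNewAmong (spoke 1 0) s σ
  bothNew-split s [] _ = refl
  bothNew-split s ((u , v) ∷ σ) (h ∷ hs) = begin
    X + #bothNew s' σ
      ≡⟨ cong₂ _+_ (sym (select-one (isUW (u , v)) (spoke 0 1 (u , v)) (spoke 1 0 (u , v)) (one-kind h))) (bothNew-split s' σ hs) ⟩
    (i₁ + i₂ + i₃) + (#bothNewAmong isUW s' σ + #bothNewAmong (spoke 0 1) s' σ + #bothNewAmong (spoke 1 0) s' σ)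
      ≡⟨ regroup i₁ i₂ i₃ (#bothNewAmong isUW s' σ) (#bothNewAmong (spoke 0 1) s' σ) (#bothNewAmong (spoke 1 0) s' σ) ⟩
    (i₁ + #bothNewAmong isUW s' σ) + (i₂ + #bothNewAmong (spoke 0 1) s' σ) + (i₃ + #bothNewAmong (spoke 1 0) s' σ) ∎
    where
    s' = u ∷ v ∷ s
    X = ⟦ fresh s u ∧ fresh s v ⟧
    i₁ = if isUW (u , v) then X else 0
    i₂ = if spoke 0 1 (u , v) then X else 0
    i₃ = if spoke 1 0 (u , v) then X else 0
    select-one : ∀ b₁ b₂ b₃ → ⟦ b₁ ⟧ + ⟦ b₂ ⟧ + ⟦ b₃ ⟧ ≡ 1 →
      (if b₁ then X else 0) + (if b₂ then X else 0) + (if b₃ then X else 0) ≡ X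
    select-one true false false e = trans (+-identityʳ _) (+-identityʳ X)
    select-one false true false e = +-identityʳ X
    select-one false false true e = refl
    regroup : ∀ a b c d e f → (a + b + c) + (d + e + f) ≡ (a + d) + (b + e) + (c + f)
    regroup = solve-∀

  bothNew-uw-seen : (s : List ℕ) (σ : List Edge) → (0 ∈ᵇ s) ∨ (1 ∈ᵇ s) ≡ true → #bothNewAmong isUW s σ ≡ 0
  bothNew-uw-seen s [] h = refl
  bothNew-uw-seen s ((u , v) ∷ σ) h =
    cong₂ _+_ (head (isUW (u , v)) refl) (bothNew-uw-seen (u ∷ v ∷ s) σ (grow (0 ∈ᵇ s) (1 ∈ᵇ s) h))
    where
    grow : ∀ a b → a ∨ b ≡ true → ((0 ≡ᵇ u) ∨ ((0 ≡ᵇ v) ∨ a)) ∨ ((1 ≡ᵇ u) ∨ ((1 ≡ᵇ v) ∨ b)) ≡ true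
    grow true b e rewrite ∨-true-r (0 ≡ᵇ u) (∨-true-r (0 ≡ᵇ v) {true} refl) = refl
    grow false true e = ∨-true-r ((0 ≡ᵇ u) ∨ ((0 ≡ᵇ v) ∨ false)) (∨-true-r (1 ≡ᵇ u) (∨-true-r (1 ≡ᵇ v) {true} refl))
    head : ∀ c → isUW (u , v) ≡ c → (if isUW (u , v) then ⟦ fresh s u ∧ fresh s v ⟧ else 0) ≡ 0
    head false e = if-false e
    head true e with eqE-sound (u , v) uw e
    ... | refl = trans (if-true e) (centre-seen (0 ∈ᵇ s) (1 ∈ᵇ s) h)
      where
      centre-seen : ∀ a b → a ∨ b ≡ true → ⟦ not a ∧ not b ⟧ ≡ 0
      centre-seen true b _ = refl
      centre-seen false true _ = refl

  bothNew-uw : (σ : List Edge) → All GSEdge σ → #bothNewAmong isUW [] σ ≡ startsWith uw σ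
  bothNew-uw [] _ = refl
  bothNew-uw ((u , v) ∷ σ) (e ∷ _) =
    trans (cong₂ _+_ (head (isUW (u , v))) (bothNew-uw-seen (u ∷ v ∷ []) σ (centre-in e)))
          (trans (+-identityʳ _) (cong ⟦_⟧ (eqE-sym (u , v) uw)))
    where
    head : ∀ c → (if c then ⟦ fresh [] u ∧ fresh [] v ⟧ else 0) ≡ ⟦ c ⟧
    head true = refl
    head false = refl
    centre-in : ∀ {e} → GSEdge e → (0 ∈ᵇ (proj₁ e ∷ proj₂ e ∷ [])) ∨ (1 ∈ᵇ (proj₁ e ∷ proj₂ e ∷ [])) ≡ true
    centre-in uw-edge = refl
    centre-in (u-edge q h) = refl
    centre-in (w-edge q h) = ∨-true-r (0 ∈ᵇ (1 ∷ q ∷ [])) refl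

  startsWith-uw-none : (l : List Edge) → All (λ e → eqE e uw ≡ false) l → startsWith uw l ≡ 0
  startsWith-uw-none [] _ = refl
  startsWith-uw-none (e ∷ l) (h ∷ _) = cong ⟦_⟧ (trans (eqE-sym uw e) h)

  startsWith-uw-filter : (z : ℕ) → touches z uw ≡ true → (σ : List Edge) → startsWith uw σ ≡ 1 →
    startsWith uw (filterᵇ (touches z) σ) ≡ 1
  startsWith-uw-filter z at-z (e ∷ σ) h with eqE uw e in ee
  ... | true rewrite sym (eqE-sound uw e ee) = trans (cong (startsWith uw) (filter-accept (touches z) σ at-z)) (cong ⟦_⟧ (eqE-refl uw))

  startsWith-01 : ∀ x σ → (startsWith x σ ≡ 0) ⊎ (startsWith x σ ≡ 1)
  startsWith-01 x [] = inj₁ refl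
  startsWith-01 x (e ∷ σ) with eqE x e
  ... | true = inj₂ refl
  ... | false = inj₁ refl

  split-one : ∀ a b → a + b ≡ 1 → (a ≡ 0 × b ≡ 1) ⊎ (a ≡ 1 × b ≡ 0)
  split-one zero b e = inj₁ (refl , e)
  split-one (suc zero) zero e = inj₂ (refl , refl)

  exactly-one : ∀ A X B Y t → A + X ≡ 1 → B + Y ≡ 1 → t ≡ A + B → t ≢ 0 → ⟦ t ≡ᵇ 1 ⟧ ≡ X + Y
  exactly-one A X B Y t e₁ e₂ et t≢0 with split-one A X e₁ | split-one B Y e₂
  ... | inj₁ (refl , refl) | inj₁ (refl , refl) with () ← t≢0 et
  ... | inj₁ (refl , refl) | inj₂ (refl , refl) rewrite et = refl
  ... | inj₂ (refl , refl) | inj₁ (refl , refl) rewrite et = refl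
  ... | inj₂ (refl , refl) | inj₂ (refl , refl) rewrite et = refl

  exactly-one-or-first : ∀ H A B E₁ X E₂ Y t → (H ≡ 0) ⊎ (H ≡ 1) → (H ≡ 1 → E₁ ≡ 1) → (H ≡ 1 → E₂ ≡ 1) →
    A + (E₁ + X) ≡ 1 → B + (E₂ + Y) ≡ 1 → t ≡ H + A + B → t ≢ 0 → ⟦ t ≡ᵇ 1 ⟧ + H ≡ (E₁ + E₂) + (X + Y)
  exactly-one-or-first H A B E₁ X E₂ Y t (inj₁ refl) _ _ e₁ e₂ et t≢0 = trans (+-identityʳ _)
    (trans (exactly-one A (E₁ + X) B (E₂ + Y) t e₁ e₂ et t≢0) (interchange E₁ X E₂ Y))
    where
    interchange : ∀ a b c d → (a + b) + (c + d) ≡ (a + c) + (b + d)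
    interchange = solve-∀
  exactly-one-or-first H A B E₁ X E₂ Y t (inj₂ refl) h₁ h₂ e₁ e₂ et t≢0 with h₁ refl | h₂ refl
  ... | refl | refl with split-one A (1 + X) e₁ | split-one B (1 + Y) e₂
  ... | inj₁ (refl , refl) | inj₁ (refl , refl) rewrite et = refl
  ... | inj₂ (_ , ()) | _
  ... | inj₁ _ | inj₂ (_ , ())

  -- The first edge is always both-new.
  bothNew≢0 : (σ : List Edge) → length σ ≢ 0 → #bothNew [] σ ≢ 0
  bothNew≢0 [] σ≢0 with () ← σ≢0 refl
  bothNew≢0 ((u , v) ∷ σ) _ ()

  oneTree-scan-GS : (Y : List ℕ) → All (2 ≤_) Y → (σ : List Edge) → All GSEdge σ → All (λ e → eqE e uw ≡ false) σ →
    any (touches 0) σ ≡ true → any (touches 1) σ ≡ true → length σ ≢ 0 →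
    (∀ q → 2 ≤ q → count (1 , q) σ ≢ 0 → count (0 , q) σ ≢ 0 → #occ q Y ≡ 1) →
    ⟦ #bothNew [] σ ≡ᵇ 1 ⟧ ≡ Σ[ Y ] (λ y → joinsVia 0 1 y false σ) + Σ[ Y ] (λ y → joinsVia 1 0 y false σ)
  oneTree-scan-GS Y Y≥2 σ edges no-uw at-u at-w σ≢0 shared =
    exactly-one (#bothNewAmong (spoke 0 1) [] σ) _ (#bothNewAmong (spoke 1 0) [] σ) _ (#bothNew [] σ)
      (side-at u,w at-u shared) (side-at w,u at-w (λ q q≥2 n₀ n₁ → shared q q≥2 n₁ n₀)) split (bothNew≢0 σ σ≢0)
    where
    side-at : ∀ {z z'} → Centres z z' → any (touches z) σ ≡ true →
      (∀ q → 2 ≤ q → count (z' , q) σ ≢ 0 → count (z , q) σ ≢ 0 → #occ q Y ≡ 1) →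
      #bothNewAmong (spoke z z') [] σ + Σ[ Y ] (λ y → joinsVia z z' y false σ) ≡ 1
    side-at {z} {z'} P at-z sh = begin
      #bothNewAmong (spoke z z') [] σ + J
        ≡⟨ cong (_+ J) (sym (trans (cong (#bothNewAmong (spoke z z') [] σ +_) no-uw-first) (+-identityʳ _))) ⟩
      FirstEdgeAt.side z z' P Y Y≥2 [] σ
        ≡⟨ FirstEdgeAt.side≡any z z' P Y Y≥2 [] σ refl (All.map (asCentreEdge P) edges) (λ q _ ()) sh ⟩
      ⟦ any (touches z) σ ⟧ ≡⟨ cong ⟦_⟧ at-z ⟩
      1 ∎
      where
      J = Σ[ Y ] (λ y → joinsVia z z' y false σ)
      no-uw-first : startsWith uw (filterᵇ (touches z) σ) ≡ 0
      no-uw-first = startsWith-uw-none _ (All.map proj₁ (All-filter (touches z) no-uw))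
    split : #bothNew [] σ ≡ #bothNewAmong (spoke 0 1) [] σ + #bothNewAmong (spoke 1 0) [] σ
    split = trans (bothNew-split [] σ edges)
      (cong (λ t → t + #bothNewAmong (spoke 0 1) [] σ + #bothNewAmong (spoke 1 0) [] σ) (bothNew-none isUW [] σ no-uw))

  oneTree-scan-GS⁺ : (Y : List ℕ) → All (2 ≤_) Y → (σ : List Edge) → All GSEdge σ →
    any (touches 0) σ ≡ true → any (touches 1) σ ≡ true → length σ ≢ 0 →
    (∀ q → 2 ≤ q → count (1 , q) σ ≢ 0 → count (0 , q) σ ≢ 0 → #occ q Y ≡ 1) →
    ⟦ #bothNew [] σ ≡ᵇ 1 ⟧ + startsWith uw σ ≡ (startsWith uw (filterᵇ (touches 0) σ) + startsWith uw (filterᵇ (touches 1) σ))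
       + (Σ[ Y ] (λ y → joinsVia 0 1 y false σ) + Σ[ Y ] (λ y → joinsVia 1 0 y false σ))
  oneTree-scan-GS⁺ Y Y≥2 σ edges at-u at-w σ≢0 shared =
    exactly-one-or-first (startsWith uw σ) (spokes u,w) (spokes w,u) (uw-first 0) _ (uw-first 1) _ (#bothNew [] σ)
      (startsWith-01 uw σ) (startsWith-uw-filter 0 refl σ) (startsWith-uw-filter 1 refl σ)
      (side-at u,w at-u shared) (side-at w,u at-w (λ q q≥2 n₀ n₁ → shared q q≥2 n₁ n₀))
      (trans (bothNew-split [] σ edges) (cong (λ t → t + spokes u,w + spokes w,u) (bothNew-uw σ edges)))
      (bothNew≢0 σ σ≢0)
    where
    spokes : ∀ {z z'} → Centres z z' → ℕ
    spokes {z} {z'} _ = #bothNewAmong (spoke z z') [] σ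
    uw-first : ℕ → ℕ
    uw-first z = startsWith uw (filterᵇ (touches z) σ)
    side-at : ∀ {z z'} (P : Centres z z') → any (touches z) σ ≡ true →
      (∀ q → 2 ≤ q → count (z' , q) σ ≢ 0 → count (z , q) σ ≢ 0 → #occ q Y ≡ 1) →
      spokes P + (uw-first z + Σ[ Y ] (λ y → joinsVia z z' y false σ)) ≡ 1
    side-at {z} {z'} P at-z sh = trans (sym (+-assoc (spokes P) (uw-first z) _))
      (trans (FirstEdgeAt.side≡any z z' P Y Y≥2 [] σ refl (All.map (asCentreEdge P) edges) (λ q _ ()) sh) (cong ⟦_⟧ at-z))

module CentreEvents where

  open import Data.Bool using (Bool; true; false; _∨_; _∧_)
  open import Data.Nat using (ℕ; suc; _+_; _*_; _≡ᵇ_; _≤_; pred)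
  open import Data.List using (List; []; _∷_; length; filterᵇ)
  open import Data.List.Relation.Unary.All as All using (All; []; _∷_)
  open import Data.List.Relation.Binary.Permutation.Propositional using (↭-sym)
  open import Data.List.Relation.Binary.Permutation.Propositional.Properties using (All-resp-↭)
  open import Data.Product using (_,_)
  open import Function using (_∘_)
  open import Relation.Binary.PropositionalEquality using (_≡_; refl; sym; trans; cong; cong₂)
  open import Defs
  open ListSums
  open Orderings
  open FirstElements
  open Equality
  open ForestTrees
  open CentreScan

  open Relation.Binary.PropositionalEquality.≡-Reasoning

  Σ-keep-at : (x : Edge) (z : ℕ) → touches z x ≡ false → (L : List Edge) →
    Σ[ L ] (λ e → ⟦ eqE e x ∨ touches z e ⟧) ≡ count x L + Σ[ L ] (λ e → ⟦ touches z e ⟧)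
  Σ-keep-at x z zx L = trans (Σ-cong L indicator) (Σ-+ L (λ e → ⟦ eqE x e ⟧) (λ e → ⟦ touches z e ⟧))
    where
    indicator : ∀ e → ⟦ eqE e x ∨ touches z e ⟧ ≡ ⟦ eqE x e ⟧ + ⟦ touches z e ⟧
    indicator e with eqE e x in ex
    ... | true rewrite eqE-sound e x ex | eqE-refl x | zx = refl
    ... | false rewrite trans (eqE-sym x e) ex = refl

  joinsVia-filter : (z z' y : ℕ) (flag : Bool) (σ : List Edge) →
    joinsVia z z' y flag σ ≡ joinsVia z z' y flag (filterᵇ (λ e → eqE e (z' , y) ∨ touches z e) σ)
  joinsVia-filter z z' y flag [] = refl
  joinsVia-filter z z' y flag (e ∷ σ) = by-cases (eqE e (z' , y)) (touches z e) refl refl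
    where
    keep = λ e → eqE e (z' , y) ∨ touches z e
    by-cases : ∀ b c → eqE e (z' , y) ≡ b → touches z e ≡ c →
      joinsVia z z' y flag (e ∷ σ) ≡ joinsVia z z' y flag (filterᵇ keep (e ∷ σ))
    by-cases true c eb ec = trans (if-true eb) (trans (joinsVia-filter z z' y true σ)
      (sym (trans (cong (joinsVia z z' y flag) (filter-accept keep σ (cong (_∨ touches z e) eb))) (if-true eb))))
    by-cases false true eb ec = trans (if-false eb) (trans (if-true ec)
      (sym (trans (cong (joinsVia z z' y flag) (filter-accept keep σ (trans (cong (_∨ touches z e) eb) ec))) (trans (if-false eb) (if-true ec)))))
    by-cases false false eb ec = trans (if-false eb) (trans (if-false ec) (trans (joinsVia-filter z z' y flag σ)
      (sym (cong (joinsVia z z' y flag) (filter-reject keep σ (trans (cong (_∨ touches z e) eb) ec))))))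

  joinsVia-startsWith₂ : (z z' y : ℕ) (τ : List Edge) → All (λ e → (eqE e (z' , y) ∨ touches z e) ≡ true) τ →
    count (z' , y) τ ≡ 1 → joinsVia z z' y false τ ≡ startsWith₂ (z' , y) (z , y) τ
  joinsVia-startsWith₂ z z' y (e ∷ τ) (k ∷ ks) c = by-cases (eqE e (z' , y)) refl
    where
    x = (z' , y)
    by-cases : ∀ b → eqE e x ≡ b → joinsVia z z' y false (e ∷ τ) ≡ startsWith₂ x (z , y) (e ∷ τ)
    by-cases true eb = trans (if-true eb) (trans (after-far τ ks (no-more-far c)) (sym (if-true (trans (eqE-sym x e) eb))))
      where
      no-more-far : ⟦ eqE x e ⟧ + count x τ ≡ 1 → count x τ ≡ 0
      no-more-far h rewrite trans (eqE-sym x e) eb = cong pred h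
      after-far : (τ : List Edge) → All (λ e → (eqE e x ∨ touches z e) ≡ true) τ → count x τ ≡ 0 → joinsVia z z' y true τ ≡ startsWith (z , y) τ
      after-far [] _ _ = refl
      after-far (e' ∷ τ') (k' ∷ _) c0 = trans (if-false e'x) (trans (if-true (trans (sym (cong (_∨ touches z e') e'x)) k')) (cong ⟦_⟧ (eqE-sym e' (z , y))))
        where
        e'x : eqE e' x ≡ false
        e'x = trans (eqE-sym e' x) (count-0-head x e' τ' c0)
    by-cases false eb = trans (if-false eb) (trans (if-true (trans (sym (cong (_∨ touches z e) eb)) k)) (sym (if-false (trans (eqE-sym x e) eb))))

  joinsVia-prob : (z z' : ℕ) → Centres z z' → (y : ℕ) → 2 ≤ y → (G : List Edge) (k : ℕ) →
    count (z' , y) G ≡ 1 → count (z , y) G ≡ 1 → Σ[ G ] (λ e → ⟦ touches z e ⟧) ≡ k →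
    sumOrd (joinsVia z z' y false) G * (suc k * k) ≡ #ord G
  joinsVia-prob z z' P y y≥2 G k c' c at-z =
    trans (cong (_* (suc k * k)) (Σ-cong (orderings G) (joinsVia-filter z z' y false)))
          (restrict-event relevant g G (suc k * k) on-relevant)
    where
    relevant = λ e → eqE e (z' , y) ∨ touches z e
    K = filterᵇ relevant G
    g = joinsVia z z' y false
    count-K' : count (z' , y) K ≡ 1
    count-K' = trans (count-filter (z' , y) relevant (cong (_∨ touches z (z' , y)) (eqE-refl (z' , y))) G) c'
    count-K : count (z , y) K ≡ 1
    count-K = trans (count-filter (z , y) relevant (∨-true-r (eqE (z , y) (z' , y)) (cong (_∨ (y ≡ᵇ z)) (≡ᵇ-refl z))) G) c
    length-K : length K ≡ suc k
    length-K = trans (length-filter-as-Σ _ G)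
      (trans (Σ-keep-at (z' , y) z (cong₂ _∨_ (far≢near P) (leaf≢near P y≥2)) G) (cong₂ _+_ c' at-z))
    on-relevant : sumOrd g K * (suc k * k) ≡ #ord K
    on-relevant = begin
      sumOrd g K * (suc k * k)
        ≡⟨ cong (_* (suc k * k)) (sumOrd-cong K (λ τ p →
             joinsVia-startsWith₂ z z' y τ (All-resp-↭ (↭-sym p) (filter-All relevant G)) (trans (Σ-↭ _ p) count-K'))) ⟩
      sumOrd (startsWith₂ (z' , y) (z , y)) K * (suc k * k)
        ≡⟨ cong (λ n → sumOrd (startsWith₂ (z' , y) (z , y)) K * (n * pred n)) (sym length-K) ⟩
      sumOrd (startsWith₂ (z' , y) (z , y)) K * (length K * pred (length K))
        ≡⟨ startsWith₂-prob (z' , y) (z , y) K count-K' count-K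
             (trans (eqE-pair z' y z y) (cong (_∧ (y ≡ᵇ y)) (far≢near P))) ⟩
      #ord K ∎

  uw-first-prob : (z : ℕ) → touches z uw ≡ true → (G : List Edge) → count uw G ≡ 1 →
    sumOrd (startsWith uw ∘ filterᵇ (touches z)) G * length (filterᵇ (touches z) G) ≡ #ord G
  uw-first-prob z at-z G c = restrict-event (touches z) (startsWith uw) G _
    (startsWith-prob uw (filterᵇ (touches z) G) (trans (count-filter uw (touches z) at-z G) c))

module GlueStars where

  open import Data.Bool using (true; false; not; _∧_)
  open import Data.Bool.Properties using (∧-zeroʳ)
  open import Data.Nat using (ℕ; zero; suc; _+_; _*_; _≡ᵇ_; _≤_; _<_; s≤s; _≤?_)
  open import Data.Nat.Properties using (+-suc; +-identityʳ; ≤-trans; ≤-refl; <⇒≢; ≰⇒>; m≤m+n; <-≤-trans; <⇒≤; n<1+n; <⇒≱; ≤∧≢⇒<; n≤1+n)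
  open import Data.List using (List; []; _∷_; map; length; _++_; concatMap)
  open import Data.List.Relation.Unary.All as All using (All; []; _∷_)
  open import Data.List.Relation.Unary.All.Properties using (map⁺; ++⁺; concat⁺)
  open import Data.Product using (_×_; _,_; proj₁; proj₂)
  open import Data.Empty using (⊥-elim)
  open import Relation.Nullary using (yes; no)
  open import Relation.Binary.PropositionalEquality using (_≡_; _≢_; refl; sym; trans; cong; cong₂; subst)
  open import Data.Nat.Tactic.RingSolver using (solve-∀)
  open import Defs
  open ListSums
  open Orderings
  open FirstElements
  open Equality
  open ForestTrees
  open CentreScan

  open Relation.Binary.PropositionalEquality.≡-Reasoning

  ≢⇒≡ᵇ-false : ∀ m n → m ≢ n → (m ≡ᵇ n) ≡ false
  ≢⇒≡ᵇ-false m n h with m ≡ᵇ n in e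
  ... | true with () ← h (≡ᵇ-sound m n e)
  ... | false = refl

  length-range : ∀ s n → length (range s n) ≡ n
  length-range s zero = refl
  length-range s (suc n) = cong suc (length-range (suc s) n)

  range-bounds : ∀ s n → All (λ q → (s ≤ q) × (q < s + n)) (range s n)
  range-bounds s zero = []
  range-bounds s (suc n) = (≤-refl , subst (s <_) (sym (+-suc s n)) (s≤s (m≤m+n s n)))
    ∷ All.map (λ {q} h → (≤-trans (<⇒≤ (n<1+n s)) (proj₁ h) , subst (q <_) (sym (+-suc s n)) (proj₂ h))) (range-bounds (suc s) n)

  Σ-range-const : ∀ s n k (f : ℕ → ℕ) → (∀ q → s ≤ q → f q ≡ k) → Σ[ range s n ] f ≡ n * k
  Σ-range-const s zero k f h = refl
  Σ-range-const s (suc n) k f h = cong₂ _+_ (h s ≤-refl) (Σ-range-const (suc s) n k f (λ q l → h q (≤-trans (n≤1+n s) l)))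

  middle-leaf : ∀ {a q} → 2 + a ≤ q → 2 ≤ q
  middle-leaf {a} l = ≤-trans (m≤m+n 2 a) l

  w-leaf : ∀ {a b q} → 2 + a + b ≤ q → 2 ≤ q
  w-leaf {a} {b} l = ≤-trans (m≤m+n 2 a) (≤-trans (m≤m+n (2 + a) b) l)

  #occ-range-below : ∀ q s n → q < s → #occ q (range s n) ≡ 0
  #occ-range-below q s zero h = refl
  #occ-range-below q s (suc n) h = cong₂ _+_ (cong ⟦_⟧ (≢⇒≡ᵇ-false q s (<⇒≢ h))) (#occ-range-below q (suc s) n (≤-trans h (<⇒≤ (n<1+n s))))

  #occ-range-above : ∀ q s n → s + n ≤ q → #occ q (range s n) ≡ 0
  #occ-range-above q s zero h = refl
  #occ-range-above q s (suc n) h = cong₂ _+_ (cong ⟦_⟧ (≢⇒≡ᵇ-false q s (λ e → <⇒≢ sq (sym e)))) (#occ-range-above q (suc s) n (subst (_≤ q) (+-suc s n) h))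
    where
    sq : s < q
    sq = <-≤-trans (subst (s <_) (sym (+-suc s n)) (s≤s (m≤m+n s n))) h

  #occ-range-inside : ∀ q s n → s ≤ q → q < s + n → #occ q (range s n) ≡ 1
  #occ-range-inside q s zero h1 h2 = ⊥-elim (<⇒≱ h2 (subst (_≤ q) (sym (+-identityʳ s)) h1))
  #occ-range-inside q s (suc n) h1 h2 with q ≡ᵇ s in e
  ... | true rewrite ≡ᵇ-sound q s e = cong suc (#occ-range-below s (suc s) n (n<1+n s))
  ... | false = #occ-range-inside q (suc s) n (≤∧≢⇒< h1 ne) (subst (q <_) (+-suc s n) h2)
    where
    ne : s ≢ q
    ne refl with () ← trans (sym (≡ᵇ-refl s)) e

  middle : ℕ → ℕ → List ℕ
  middle a b = range (2 + a) b

  GS-All : (P : Edge → Set) → (∀ q → 2 ≤ q → P (0 , q)) → (∀ q → 2 ≤ q → P (1 , q)) → ∀ a b c → All P (GS a b c)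
  GS-All P h0 h1 a b c = ++⁺ (map⁺ (All.map (λ { (l , _) → h0 _ l }) (range-bounds 2 a)))
    (++⁺ (concat⁺ (map⁺ (All.map (λ { (l , _) → h0 _ (middle-leaf {a} l) ∷ h1 _ (middle-leaf {a} l) ∷ [] }) (range-bounds (2 + a) b))))
         (map⁺ (All.map (λ {x} h → h1 x (w-leaf {a} {b} (proj₁ h))) (range-bounds (2 + a + b) c))))

  middle≥2 : ∀ a b → All (2 ≤_) (middle a b)
  middle≥2 a b = All.map (λ { (l , _) → middle-leaf {a} l }) (range-bounds (2 + a) b)

  Σ-GS : (f : Edge → ℕ) (a b c : ℕ) → Σ[ GS a b c ] f ≡
    Σ[ range 2 a ] (λ x → f (0 , x)) + (Σ[ range (2 + a) b ] (λ y → f (0 , y) + (f (1 , y) + 0)) + Σ[ range (2 + a + b) c ] (λ z → f (1 , z)))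
  Σ-GS f a b c = trans (Σ-++ R1 (PP ++ R3) f) (cong₂ _+_ (Σ-map (range 2 a) f (λ x → (0 , x)))
    (trans (Σ-++ PP R3 f) (cong₂ _+_ (Σ-concatMap (λ y → (0 , y) ∷ (1 , y) ∷ []) (range (2 + a) b) f) (Σ-map (range (2 + a + b) c) f (λ z → (1 , z))))))
    where
    R1 = map (λ x → (0 , x)) (range 2 a)
    PP = concatMap (λ y → (0 , y) ∷ (1 , y) ∷ []) (range (2 + a) b)
    R3 = map (λ z → (1 , z)) (range (2 + a + b) c)

  count-u-GS : ∀ a b c q → count (0 , q) (GS a b c) ≡ #occ q (range 2 a) + #occ q (range (2 + a) b)
  count-u-GS a b c q = trans (Σ-GS (λ e → ⟦ eqE (0 , q) e ⟧) a b c)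
    (cong₂ _+_ (Σ-cong (range 2 a) (λ x → cong ⟦_⟧ (eqE-pair 0 q 0 x)))
      (trans (cong₂ _+_ (Σ-cong (range (2 + a) b) (λ y → trans (cong₂ (λ u v → ⟦ u ⟧ + (⟦ v ⟧ + 0)) (eqE-pair 0 q 0 y) (eqE-pair 0 q 1 y)) (+-identityʳ _)))
                        (Σ-zero (range (2 + a + b) c) (λ z → cong ⟦_⟧ (eqE-pair 0 q 1 z))))
             (+-identityʳ _)))

  count-w-GS : ∀ a b c q → count (1 , q) (GS a b c) ≡ #occ q (range (2 + a) b) + #occ q (range (2 + a + b) c)
  count-w-GS a b c q = trans (Σ-GS (λ e → ⟦ eqE (1 , q) e ⟧) a b c)
    (trans (cong₂ _+_ (Σ-zero (range 2 a) (λ x → cong ⟦_⟧ (eqE-pair 1 q 0 x)))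
      (cong₂ _+_ (Σ-cong (range (2 + a) b) (λ y → trans (cong₂ (λ u v → ⟦ u ⟧ + (⟦ v ⟧ + 0)) (eqE-pair 1 q 0 y) (eqE-pair 1 q 1 y)) (+-identityʳ _)))
                 (Σ-cong (range (2 + a + b) c) (λ z → cong ⟦_⟧ (eqE-pair 1 q 1 z))))) refl)

  count-u-middle : ∀ a b c y → 2 + a ≤ y → y < 2 + a + b → count (0 , y) (GS a b c) ≡ 1
  count-u-middle a b c y l h = trans (count-u-GS a b c y) (cong₂ _+_ (#occ-range-above y 2 a l) (#occ-range-inside y (2 + a) b l h))

  count-w-middle : ∀ a b c y → 2 + a ≤ y → y < 2 + a + b → count (1 , y) (GS a b c) ≡ 1
  count-w-middle a b c y l h = trans (count-w-GS a b c y) (trans (cong₂ _+_ (#occ-range-inside y (2 + a) b l h) (#occ-range-below y (2 + a + b) c h)) refl)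

  shared⇒middle : ∀ a b c q → 2 ≤ q → count (1 , q) (GS a b c) ≢ 0 → count (0 , q) (GS a b c) ≢ 0 → #occ q (middle a b) ≡ 1
  shared⇒middle a b c q q2 n1 n0 with (2 + a) ≤? q
  ... | no ¬l = ⊥-elim (n1 (trans (count-w-GS a b c q) (cong₂ _+_ (#occ-range-below q (2 + a) b lt) (#occ-range-below q (2 + a + b) c (≤-trans lt (m≤m+n (2 + a) b))))))
    where
    lt : q < 2 + a
    lt = ≰⇒> ¬l
  ... | yes l with (2 + a + b) ≤? q
  ...   | yes h = ⊥-elim (n0 (trans (count-u-GS a b c q) (cong₂ _+_ (#occ-range-above q 2 a l) (#occ-range-above q (2 + a) b h))))
  ...   | no ¬h = #occ-range-inside q (2 + a) b l (≰⇒> ¬h)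

  #at-u-GS : ∀ a b c → Σ[ GS a b c ] (λ e → ⟦ touches 0 e ⟧) ≡ a + b
  #at-u-GS a b c = trans (Σ-GS (λ e → ⟦ touches 0 e ⟧) a b c)
    (trans (cong₂ _+_ (Σ-range-const 2 a 1 _ (λ _ _ → refl))
             (cong₂ _+_ (Σ-range-const (2 + a) b 1 _ (λ q l → cong (λ t → 1 + (⟦ t ⟧ + 0)) (leaf≢0 (middle-leaf {a} l))))
                        (Σ-range-const (2 + a + b) c 0 _ (λ q l → cong ⟦_⟧ (leaf≢0 (w-leaf {a} {b} l))))))
           (degree a b c))
    where
    degree : ∀ a b c → a * 1 + (b * 1 + c * 0) ≡ a + b
    degree = solve-∀

  #at-w-GS : ∀ a b c → Σ[ GS a b c ] (λ e → ⟦ touches 1 e ⟧) ≡ b + c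
  #at-w-GS a b c = trans (Σ-GS (λ e → ⟦ touches 1 e ⟧) a b c)
    (trans (cong₂ _+_ (Σ-range-const 2 a 0 _ (λ q l → cong ⟦_⟧ (leaf≢1 l)))
             (cong₂ _+_ (Σ-range-const (2 + a) b 1 _ (λ q l → cong (λ t → ⟦ t ⟧ + 1) (leaf≢1 (middle-leaf {a} l))))
                        (Σ-range-const (2 + a + b) c 1 _ (λ _ _ → refl))))
           (degree a b c))
    where
    degree : ∀ a b c → a * 0 + (b * 1 + c * 1) ≡ b + c
    degree = solve-∀

  loopless-GS : ∀ a b c → Loopless (GS a b c)
  loopless-GS = GS-All (λ e → (proj₁ e ≡ᵇ proj₂ e) ≡ false) (λ q h → trans (≡ᵇ-sym 0 q) (leaf≢0 h)) (λ q h → trans (≡ᵇ-sym 1 q) (leaf≢1 h))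

  no-uw-GS : ∀ a b c → All (λ e → eqE e uw ≡ false) (GS a b c)
  no-uw-GS = GS-All (λ e → eqE e uw ≡ false) (λ q h → trans (eqE-pair 0 q 0 1) (leaf≢1 h)) (λ q h → eqE-pair 1 q 0 1)

  edges-GS : ∀ a b c → All GSEdge (GS a b c)
  edges-GS = GS-All GSEdge u-edge w-edge

  middle-counts : ∀ a b c y → 2 + a ≤ y → y < 2 + a + b → count (0 , y) (GS a b c) ≡ 1 × count (1 , y) (GS a b c) ≡ 1
  middle-counts a b c y lo hi = count-u-middle a b c y lo hi , count-w-middle a b c y lo hi

  count-GS⁺ : ∀ q → 2 ≤ q → ∀ p a b c → count (p , q) (GS⁺ a b c) ≡ count (p , q) (GS a b c)
  count-GS⁺ q q2 p a b c = cong (λ t → ⟦ t ⟧ + count (p , q) (GS a b c))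
    (trans (eqE-pair p q 0 1) (trans (cong ((p ≡ᵇ 0) ∧_) (leaf≢1 q2)) (∧-zeroʳ (p ≡ᵇ 0))))

  length-GS : ∀ a b c → length (GS a b c) ≡ a + 2 * b + c
  length-GS a b c = trans (length-as-Σ (GS a b c)) (trans (Σ-GS (λ _ → 1) a b c)
    (trans (cong₂ _+_ (Σ-range-const 2 a 1 _ (λ _ _ → refl))
             (cong₂ _+_ (Σ-range-const (2 + a) b 2 _ (λ _ _ → refl)) (Σ-range-const (2 + a + b) c 1 _ (λ _ _ → refl))))
           (size a b c)))
    where
    size : ∀ a b c → a * 1 + (b * 2 + c * 1) ≡ a + 2 * b + c
    size = solve-∀

  count-uw-GS⁺ : ∀ a b c → count uw (GS⁺ a b c) ≡ 1
  count-uw-GS⁺ a b c = cong₂ _+_ (cong ⟦_⟧ (eqE-refl uw))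
    (trans (Σ-congAll (All.map (λ {e} h → cong ⟦_⟧ (trans (eqE-sym uw e) h)) (no-uw-GS a b c))) (Σ-zero (GS a b c) (λ _ → refl)))

  middle-counts-GS⁺ : ∀ a b c y → 2 + a ≤ y → y < 2 + a + b → count (0 , y) (GS⁺ a b c) ≡ 1 × count (1 , y) (GS⁺ a b c) ≡ 1
  middle-counts-GS⁺ a b c y lo hi =
    trans (count-GS⁺ y y≥2 0 a b c) (count-u-middle a b c y lo hi) , trans (count-GS⁺ y y≥2 1 a b c) (count-w-middle a b c y lo hi)
    where
    y≥2 = middle-leaf {a} lo

module Fractions where

  open import Data.Nat using (zero; suc) renaming (_+_ to _+ℕ_; _*_ to _*ℕ_)
  open import Data.Integer using (+_) renaming (_+_ to _+ℤ_; _*_ to _*ℤ_)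
  open import Data.Integer.Properties using (pos-+; pos-*)
  open import Data.Rational using (ℚ; _+_; _-_)
  open import Data.Rational.Properties using (fromℚᵘ-cong; toℚᵘ-injective; toℚᵘ-homo-+; toℚᵘ-fromℚᵘ; +-assoc; +-inverseʳ; +-identityʳ)
  open import Data.Rational.Unnormalised using (mkℚᵘ; *≡*)
  import Data.Rational.Unnormalised.Properties as ℚᵘ
  open import Relation.Binary.PropositionalEquality using (_≡_; _≢_; refl; sym; trans; cong; cong₂)
  open import Data.Nat.Tactic.RingSolver using (solve-∀)
  open import Defs using (frac)

  frac-cross : ∀ x y m d → x *ℕ d ≡ y *ℕ m → m ≢ 0 → d ≢ 0 → frac x m ≡ frac y d
  frac-cross x y zero d eq m≢0 _ with () ← m≢0 refl
  frac-cross x y (suc m) zero eq _ d≢0 with () ← d≢0 refl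
  frac-cross x y (suc m) (suc d) eq _ _ = fromℚᵘ-cong {mkℚᵘ (+ x) m} {mkℚᵘ (+ y) d}
    (*≡* (trans (sym (pos-* x (suc d))) (trans (cong +_ eq) (pos-* y (suc m)))))

  frac-+ : ∀ x y m → frac x m + frac y m ≡ frac (x +ℕ y) m
  frac-+ x y zero = refl
  frac-+ x y (suc m) = toℚᵘ-injective
    (ℚᵘ.≃-trans (toℚᵘ-homo-+ (frac x (suc m)) (frac y (suc m)))
    (ℚᵘ.≃-trans (ℚᵘ.+-cong (toℚᵘ-fromℚᵘ (mkℚᵘ (+ x) m)) (toℚᵘ-fromℚᵘ (mkℚᵘ (+ y) m)))
    (ℚᵘ.≃-trans (*≡* cross)
    (ℚᵘ.≃-sym (toℚᵘ-fromℚᵘ (mkℚᵘ (+ (x +ℕ y)) m))))))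
    where
    M = suc m
    cross : ((+ x) *ℤ (+ M) +ℤ (+ y) *ℤ (+ M)) *ℤ (+ M) ≡ (+ (x +ℕ y)) *ℤ (+ (M *ℕ M))
    cross = begin
      ((+ x) *ℤ (+ M) +ℤ (+ y) *ℤ (+ M)) *ℤ (+ M)
        ≡⟨ cong (_*ℤ (+ M)) (sym (trans (pos-+ (x *ℕ M) (y *ℕ M)) (cong₂ _+ℤ_ (pos-* x M) (pos-* y M)))) ⟩
      (+ (x *ℕ M +ℕ y *ℕ M)) *ℤ (+ M) ≡⟨ sym (pos-* (x *ℕ M +ℕ y *ℕ M) M) ⟩
      + ((x *ℕ M +ℕ y *ℕ M) *ℕ M)     ≡⟨ cong +_ (factor x y M) ⟩
      + ((x +ℕ y) *ℕ (M *ℕ M))        ≡⟨ pos-* (x +ℕ y) (M *ℕ M) ⟩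
      (+ (x +ℕ y)) *ℤ (+ (M *ℕ M))    ∎
      where
      open Relation.Binary.PropositionalEquality.≡-Reasoning
      factor : ∀ x y M → (x *ℕ M +ℕ y *ℕ M) *ℕ M ≡ (x +ℕ y) *ℕ (M *ℕ M)
      factor = solve-∀

  +⇒- : (p q r : ℚ) → p + q ≡ r → p ≡ r - q
  +⇒- p q r e = sym (trans (cong (_- q) (sym e))
    (trans (+-assoc p q _) (trans (cong (λ t → p + t) (+-inverseʳ q)) (+-identityʳ p))))

module Main where

  open import Data.Bool using (Bool; true; false)
  open import Data.Nat using (ℕ; suc; _≡ᵇ_; _≤_; _<_; s≤s) renaming (_+_ to _+ℕ_; _*_ to _*ℕ_)
  open import Data.Nat.Properties using (+-comm; 1+n≢0)
  open import Data.List using (List; []; _∷_; length; filterᵇ)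
  open import Data.Bool.ListAction using (any)
  open import Data.List.Relation.Unary.All as All using (All; []; _∷_)
  open import Data.List.Relation.Binary.Permutation.Propositional using (_↭_; ↭-sym)
  open import Data.List.Relation.Binary.Permutation.Propositional.Properties using (All-resp-↭)
  open import Data.Product using (_×_; _,_; proj₁; proj₂; swap)
  open import Function using (_∘_)
  open import Relation.Binary.PropositionalEquality using (_≡_; _≢_; refl; sym; trans; cong; cong₂)
  open import Data.Rational using (_+_; _-_)
  open import Data.Nat.Tactic.RingSolver using (solve-∀)
  open import Defs
  open ListSums
  open Orderings
  open FirstElements
  open Equality
  open ForestTrees
  open CentreScan
  open GlueStars
  open CentreEvents
  open Fractions
  open Relation.Binary.PropositionalEquality.≡-Reasoning

  -- joins z z' σ counts the middle vertices y for which the first edge of σ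
  -- at z is (z, y) and comes after (z', y); at most one such y exists.
  joins : ℕ → ℕ → List ℕ → List Edge → ℕ
  joins z z' Y σ = Σ[ Y ] (λ y → joinsVia z z' y false σ)

  joins-prob : (z z' : ℕ) → Centres z z' → (a b : ℕ) (G : List Edge) (k : ℕ) →
    (∀ y → 2 +ℕ a ≤ y → y < 2 +ℕ a +ℕ b → count (z' , y) G ≡ 1 × count (z , y) G ≡ 1) →
    Σ[ G ] (λ e → ⟦ touches z e ⟧) ≡ k →
    sumOrd (joins z z' (middle a b)) G *ℕ (suc k *ℕ k) ≡ b *ℕ #ord G
  joins-prob z z' P a b G k counts atZ = begin
    sumOrd (joins z z' Y) G *ℕ (suc k *ℕ k)
      ≡⟨ cong (_*ℕ (suc k *ℕ k)) (Σ-swap (orderings G) Y (λ y → joinsVia z z' y false)) ⟩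
    Σ[ Y ] (λ y → sumOrd (joinsVia z z' y false) G) *ℕ (suc k *ℕ k)
      ≡⟨ Σ-*-const Y _ _ _ (All.map (λ {y} → each y) (range-bounds (2 +ℕ a) b)) ⟩
    length Y *ℕ #ord G
      ≡⟨ cong (_*ℕ #ord G) (length-range (2 +ℕ a) b) ⟩
    b *ℕ #ord G ∎
    where
    Y = middle a b
    each : ∀ y → (2 +ℕ a ≤ y) × (y < 2 +ℕ a +ℕ b) → sumOrd (joinsVia z z' y false) G *ℕ (suc k *ℕ k) ≡ #ord G
    each y (lo , hi) = joinsVia-prob z z' P y (middle-leaf {a} lo) G k
      (proj₁ (counts y lo hi)) (proj₂ (counts y lo hi)) atZ

  #oneTree : Graph → ℕ
  #oneTree G = length (filterᵇ (λ σ → numTrees G σ ≡ᵇ 1) (orderings G))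

  #oneTree-as-sum : (G : Graph) → #oneTree G ≡ sumOrd (λ σ → ⟦ numTrees G σ ≡ᵇ 1 ⟧) G
  #oneTree-as-sum G = length-filter-as-Σ _ (orderings G)

  P-as-frac : (G : Graph) → P G 1 ≡ frac (#oneTree G) (#ord G)
  P-as-frac G = cong (frac (#oneTree G)) (length-as-Σ (orderings G))

  1≤⇒≢0 : ∀ {n} → 1 ≤ n → n ≢ 0
  1≤⇒≢0 (s≤s _) ()

  any⇒nonEmpty : {A : Set} (p : A → Bool) (σ : List A) → any p σ ≡ true → length σ ≢ 0
  any⇒nonEmpty p [] () _
  any⇒nonEmpty p (x ∷ σ) _ ()

  oneTree-GS : (a b c : ℕ) → 1 ≤ a +ℕ b → 1 ≤ b +ℕ c → (σ : List Edge) → σ ↭ GS a b c →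
    ⟦ numTrees (GS a b c) σ ≡ᵇ 1 ⟧ ≡ joins 0 1 (middle a b) σ +ℕ joins 1 0 (middle a b) σ
  oneTree-GS a b c hab hbc σ p = trans (cong (λ t → ⟦ t ≡ᵇ 1 ⟧) (numTrees≡#bothNew G σ p (loopless-GS a b c)))
    (oneTree-scan-GS (middle a b) (middle≥2 a b) σ (All-resp-↭ (↭-sym p) (edges-GS a b c)) (All-resp-↭ (↭-sym p) (no-uw-GS a b c))
      atU atW (any⇒nonEmpty (touches 0) σ atU) middleOnly)
    where
    G = GS a b c
    atU : any (touches 0) σ ≡ true
    atU = any-≢0 (touches 0) σ (λ e → 1≤⇒≢0 hab (trans (sym (trans (Σ-↭ _ p) (#at-u-GS a b c))) e))
    atW : any (touches 1) σ ≡ true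
    atW = any-≢0 (touches 1) σ (λ e → 1≤⇒≢0 hbc (trans (sym (trans (Σ-↭ _ p) (#at-w-GS a b c))) e))
    middleOnly : ∀ q → 2 ≤ q → count (1 , q) σ ≢ 0 → count (0 , q) σ ≢ 0 → #occ q (middle a b) ≡ 1
    middleOnly q q2 n1 n0 = shared⇒middle a b c q q2 (λ e → n1 (trans (Σ-↭ _ p) e)) (λ e → n0 (trans (Σ-↭ _ p) e))

  oneTree-GS⁺ : (a b c : ℕ) (σ : List Edge) → σ ↭ GS⁺ a b c →
    ⟦ numTrees (GS⁺ a b c) σ ≡ᵇ 1 ⟧ +ℕ startsWith uw σ ≡
      (startsWith uw (filterᵇ (touches 0) σ) +ℕ startsWith uw (filterᵇ (touches 1) σ))
        +ℕ (joins 0 1 (middle a b) σ +ℕ joins 1 0 (middle a b) σ)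
  oneTree-GS⁺ a b c σ p = trans (cong (λ t → ⟦ t ≡ᵇ 1 ⟧ +ℕ startsWith uw σ) (numTrees≡#bothNew G' σ p (refl ∷ loopless-GS a b c)))
    (oneTree-scan-GS⁺ (middle a b) (middle≥2 a b) σ (All-resp-↭ (↭-sym p) (uw-edge ∷ edges-GS a b c)) atU atW (any⇒nonEmpty (touches 0) σ atU) middleOnly)
    where
    G' = GS⁺ a b c
    atU : any (touches 0) σ ≡ true
    atU = any-≢0 (touches 0) σ (λ e → 1+n≢0 (trans (sym (trans (Σ-↭ _ p) (cong suc (#at-u-GS a b c)))) e))
    atW : any (touches 1) σ ≡ true
    atW = any-≢0 (touches 1) σ (λ e → 1+n≢0 (trans (sym (trans (Σ-↭ _ p) (cong suc (#at-w-GS a b c)))) e))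
    middleOnly : ∀ q → 2 ≤ q → count (1 , q) σ ≢ 0 → count (0 , q) σ ≢ 0 → #occ q (middle a b) ≡ 1
    middleOnly q q2 n1 n0 = shared⇒middle a b c q q2 (λ e → n1 (trans (Σ-↭ _ p) (trans (count-GS⁺ q q2 1 a b c) e)))
                                           (λ e → n0 (trans (Σ-↭ _ p) (trans (count-GS⁺ q q2 0 a b c) e)))

  joins-frac : (z z' : ℕ) → Centres z z' → (a b : ℕ) (G : List Edge) (k : ℕ) → 1 ≤ k →
    Σ[ G ] (λ e → ⟦ touches z e ⟧) ≡ k →
    (∀ y → 2 +ℕ a ≤ y → y < 2 +ℕ a +ℕ b → count (z' , y) G ≡ 1 × count (z , y) G ≡ 1) →
    frac (sumOrd (joins z z' (middle a b)) G) (#ord G) ≡ frac b ((k +ℕ 1) *ℕ k)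
  joins-frac z z' P a b G (suc k) _ at-z counts = frac-cross _ b (#ord G) ((suc k +ℕ 1) *ℕ suc k)
    (trans (cong (λ n → sumOrd (joins z z' (middle a b)) G *ℕ (n *ℕ suc k)) (+-comm (suc k) 1))
           (joins-prob z z' P a b G (suc k) counts at-z))
    (#ord≢0 G) (λ ())

  -- In GS⁺, with k = m + 1 edges at z: the orderings whose first edge at z
  -- is uw (probability 1/k) together with the joins (probability
  -- b/((k+1)k)) make up probability (b+k+1)/(k(k+1)).
  side-frac-GS⁺ : (z z' : ℕ) → Centres z z' → (a b c m : ℕ) →
    Σ[ GS⁺ a b c ] (λ e → ⟦ touches z e ⟧) ≡ suc m →
    (∀ y → 2 +ℕ a ≤ y → y < 2 +ℕ a +ℕ b → count (z' , y) (GS⁺ a b c) ≡ 1 × count (z , y) (GS⁺ a b c) ≡ 1) →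
    frac (sumOrd (startsWith uw ∘ filterᵇ (touches z)) (GS⁺ a b c) +ℕ sumOrd (joins z z' (middle a b)) (GS⁺ a b c)) (#ord (GS⁺ a b c))
      ≡ frac (b +ℕ suc (suc m)) (suc m *ℕ suc (suc m))
  side-frac-GS⁺ z z' P a b c m at-z counts = frac-cross (F +ℕ J) (b +ℕ suc (suc m)) M (suc m *ℕ suc (suc m))
    (begin
      (F +ℕ J) *ℕ (suc m *ℕ suc (suc m))              ≡⟨ expand F J (suc m) ⟩
      F *ℕ suc m *ℕ suc (suc m) +ℕ J *ℕ (suc (suc m) *ℕ suc m)
        ≡⟨ cong₂ (λ s t → s *ℕ suc (suc m) +ℕ t) uw-first (joins-prob z z' P a b G (suc m) counts at-z) ⟩
      M *ℕ suc (suc m) +ℕ b *ℕ M                      ≡⟨ collect M m b ⟩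
      (b +ℕ suc (suc m)) *ℕ M                         ∎)
    (#ord≢0 G) (λ ())
    where
    G = GS⁺ a b c
    M = #ord G
    F = sumOrd (startsWith uw ∘ filterᵇ (touches z)) G
    J = sumOrd (joins z z' (middle a b)) G
    uw-first : F *ℕ suc m ≡ M
    uw-first = trans (cong (F *ℕ_) (sym (trans (length-filter-as-Σ (touches z) G) at-z)))
                     (uw-first-prob z (uw-touches P) G (count-uw-GS⁺ a b c))
    expand : ∀ F J k → (F +ℕ J) *ℕ (k *ℕ (1 +ℕ k)) ≡ F *ℕ k *ℕ (1 +ℕ k) +ℕ J *ℕ ((1 +ℕ k) *ℕ k)
    expand = solve-∀
    collect : ∀ M m b → M *ℕ (2 +ℕ m) +ℕ b *ℕ M ≡ (b +ℕ (2 +ℕ m)) *ℕ M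
    collect = solve-∀

  uw-first-frac-GS⁺ : (a b c : ℕ) →
    frac (sumOrd (startsWith uw) (GS⁺ a b c)) (#ord (GS⁺ a b c)) ≡ frac 1 (a +ℕ 2 *ℕ b +ℕ c +ℕ 1)
  uw-first-frac-GS⁺ a b c = frac-cross H 1 M _
    (trans (cong (H *ℕ_) (trans (+-comm _ 1) (cong suc (sym (length-GS a b c)))))
           (trans (startsWith-prob uw G (count-uw-GS⁺ a b c)) (sym (+-comm M 0))))
    (#ord≢0 G) (λ e → 1+n≢0 (trans (+-comm 1 _) e))
    where
    G = GS⁺ a b c
    M = #ord G
    H = sumOrd (startsWith uw) G

  theorem-GS : (a b c : ℕ) → 1 ≤ a +ℕ b → 1 ≤ b +ℕ c →
    P (GS a b c) 1 ≡ frac b ((b +ℕ c +ℕ 1) *ℕ (b +ℕ c)) + frac b ((a +ℕ b +ℕ 1) *ℕ (a +ℕ b))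
  theorem-GS a b c hab hbc = begin
    P G 1                            ≡⟨ P-as-frac G ⟩
    frac (#oneTree G) M              ≡⟨ cong (λ n → frac n M) one-tree ⟩
    frac (J 1 0 +ℕ J 0 1) M          ≡⟨ sym (frac-+ (J 1 0) (J 0 1) M) ⟩
    frac (J 1 0) M + frac (J 0 1) M
      ≡⟨ cong₂ _+_ (joins-frac 1 0 w,u a b G (b +ℕ c) hbc (#at-w-GS a b c) (middle-counts a b c))
                   (joins-frac 0 1 u,w a b G (a +ℕ b) hab (#at-u-GS a b c) (λ y lo hi → swap (middle-counts a b c y lo hi))) ⟩
    frac b ((b +ℕ c +ℕ 1) *ℕ (b +ℕ c)) + frac b ((a +ℕ b +ℕ 1) *ℕ (a +ℕ b)) ∎
    where
    G = GS a b c
    M = #ord G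
    J : ℕ → ℕ → ℕ
    J z z' = sumOrd (joins z z' (middle a b)) G
    one-tree : #oneTree G ≡ J 1 0 +ℕ J 0 1
    one-tree = begin
      #oneTree G                               ≡⟨ #oneTree-as-sum G ⟩
      sumOrd (λ σ → ⟦ numTrees G σ ≡ᵇ 1 ⟧) G   ≡⟨ sumOrd-cong G (oneTree-GS a b c hab hbc) ⟩
      sumOrd (λ σ → joins 0 1 (middle a b) σ +ℕ joins 1 0 (middle a b) σ) G
                                               ≡⟨ Σ-+ (orderings G) _ _ ⟩
      J 0 1 +ℕ J 1 0                           ≡⟨ +-comm (J 0 1) (J 1 0) ⟩
      J 1 0 +ℕ J 0 1                           ∎

  oneTree-split-GS⁺ : (a b c : ℕ) →
    let G = GS⁺ a b c
        F = λ z → sumOrd (startsWith uw ∘ filterᵇ (touches z)) G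
        J = λ z z' → sumOrd (joins z z' (middle a b)) G
    in #oneTree G +ℕ sumOrd (startsWith uw) G ≡ (F 1 +ℕ J 1 0) +ℕ (F 0 +ℕ J 0 1)
  oneTree-split-GS⁺ a b c = begin
    #oneTree G +ℕ H
      ≡⟨ cong (_+ℕ H) (#oneTree-as-sum G) ⟩
    sumOrd (λ σ → ⟦ numTrees G σ ≡ᵇ 1 ⟧) G +ℕ H
      ≡⟨ sym (Σ-+ (orderings G) _ _) ⟩
    sumOrd (λ σ → ⟦ numTrees G σ ≡ᵇ 1 ⟧ +ℕ startsWith uw σ) G
      ≡⟨ sumOrd-cong G (oneTree-GS⁺ a b c) ⟩
    sumOrd (λ σ → (startsWith uw (filterᵇ (touches 0) σ) +ℕ startsWith uw (filterᵇ (touches 1) σ))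
                    +ℕ (joins 0 1 Y σ +ℕ joins 1 0 Y σ)) G
      ≡⟨ trans (Σ-+ (orderings G) _ _) (cong₂ _+ℕ_ (Σ-+ (orderings G) _ _) (Σ-+ (orderings G) _ _)) ⟩
    (F 0 +ℕ F 1) +ℕ (J 0 1 +ℕ J 1 0)
      ≡⟨ regroup (F 0) (F 1) (J 0 1) (J 1 0) ⟩
    (F 1 +ℕ J 1 0) +ℕ (F 0 +ℕ J 0 1) ∎
    where
    G = GS⁺ a b c
    Y = middle a b
    H = sumOrd (startsWith uw) G
    F : ℕ → ℕ
    F z = sumOrd (startsWith uw ∘ filterᵇ (touches z)) G
    J : ℕ → ℕ → ℕ
    J z z' = sumOrd (joins z z' Y) G
    regroup : ∀ p q r s → (p +ℕ q) +ℕ (r +ℕ s) ≡ (q +ℕ s) +ℕ (p +ℕ r)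
    regroup = solve-∀

  side-form : ∀ b o → frac (b +ℕ suc (suc (b +ℕ o))) (suc (b +ℕ o) *ℕ suc (suc (b +ℕ o)))
    ≡ frac (2 *ℕ b +ℕ o +ℕ 2) ((b +ℕ o +ℕ 1) *ℕ (b +ℕ o +ℕ 2))
  side-form b o = cong₂ frac (numerator b o) (denominator b o)
    where
    numerator : ∀ b o → b +ℕ suc (suc (b +ℕ o)) ≡ 2 *ℕ b +ℕ o +ℕ 2
    numerator = solve-∀
    denominator : ∀ b o → suc (b +ℕ o) *ℕ suc (suc (b +ℕ o)) ≡ (b +ℕ o +ℕ 1) *ℕ (b +ℕ o +ℕ 2)
    denominator = solve-∀

  w-side-GS⁺ : (a b c : ℕ) →
    frac (sumOrd (startsWith uw ∘ filterᵇ (touches 1)) (GS⁺ a b c) +ℕ sumOrd (joins 1 0 (middle a b)) (GS⁺ a b c)) (#ord (GS⁺ a b c))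
      ≡ frac (2 *ℕ b +ℕ c +ℕ 2) ((b +ℕ c +ℕ 1) *ℕ (b +ℕ c +ℕ 2))
  w-side-GS⁺ a b c = trans (side-frac-GS⁺ 1 0 w,u a b c (b +ℕ c) (cong suc (#at-w-GS a b c)) (middle-counts-GS⁺ a b c))
    (side-form b c)

  u-side-GS⁺ : (a b c : ℕ) →
    frac (sumOrd (startsWith uw ∘ filterᵇ (touches 0)) (GS⁺ a b c) +ℕ sumOrd (joins 0 1 (middle a b)) (GS⁺ a b c)) (#ord (GS⁺ a b c))
      ≡ frac (2 *ℕ b +ℕ a +ℕ 2) ((b +ℕ a +ℕ 1) *ℕ (b +ℕ a +ℕ 2))
  u-side-GS⁺ a b c = trans (side-frac-GS⁺ 0 1 u,w a b c (b +ℕ a) (cong suc (trans (#at-u-GS a b c) (+-comm a b)))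
                                         (λ y lo hi → swap (middle-counts-GS⁺ a b c y lo hi)))
    (side-form b a)

  -- Second formula: P(GS⁺,1) + P(uw first) = sum of the two sides.
  theorem-GS⁺ : (a b c : ℕ) →
    P (GS⁺ a b c) 1 ≡
      (frac (2 *ℕ b +ℕ c +ℕ 2) ((b +ℕ c +ℕ 1) *ℕ (b +ℕ c +ℕ 2))
        + frac (2 *ℕ b +ℕ a +ℕ 2) ((b +ℕ a +ℕ 1) *ℕ (b +ℕ a +ℕ 2)))
        - frac 1 (a +ℕ 2 *ℕ b +ℕ c +ℕ 1)
  theorem-GS⁺ a b c = trans (P-as-frac G) (+⇒- _ _ _ (begin
    frac (#oneTree G) M + frac 1 (a +ℕ 2 *ℕ b +ℕ c +ℕ 1)
      ≡⟨ cong (frac (#oneTree G) M +_) (sym (uw-first-frac-GS⁺ a b c)) ⟩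
    frac (#oneTree G) M + frac H M    ≡⟨ frac-+ (#oneTree G) H M ⟩
    frac (#oneTree G +ℕ H) M          ≡⟨ cong (λ n → frac n M) (oneTree-split-GS⁺ a b c) ⟩
    frac (W +ℕ U) M                   ≡⟨ sym (frac-+ W U M) ⟩
    frac W M + frac U M               ≡⟨ cong₂ _+_ (w-side-GS⁺ a b c) (u-side-GS⁺ a b c) ⟩
    frac (2 *ℕ b +ℕ c +ℕ 2) ((b +ℕ c +ℕ 1) *ℕ (b +ℕ c +ℕ 2))
      + frac (2 *ℕ b +ℕ a +ℕ 2) ((b +ℕ a +ℕ 1) *ℕ (b +ℕ a +ℕ 2)) ∎))
    where
    G = GS⁺ a b c
    M = #ord G
    H = sumOrd (startsWith uw) G
    W = sumOrd (startsWith uw ∘ filterᵇ (touches 1)) G +ℕ sumOrd (joins 1 0 (middle a b)) G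
    U = sumOrd (startsWith uw ∘ filterᵇ (touches 0)) G +ℕ sumOrd (joins 0 1 (middle a b)) G

open import Defs
open import Data.Nat using (ℕ; _≤_) renaming (_+_ to _+ℕ_; _*_ to _*ℕ_)
open import Data.Rational using (_+_; _-_)
open import Data.Product using (_×_; _,_)
open import Relation.Binary.PropositionalEquality using (_≡_)
open Main using (theorem-GS; theorem-GS⁺)

theorem3 :
  ((a b c : ℕ) → 1 ≤ a +ℕ b → 1 ≤ b +ℕ c →
    P (GS a b c) 1 ≡
      frac b ((b +ℕ c +ℕ 1) *ℕ (b +ℕ c)) + frac b ((a +ℕ b +ℕ 1) *ℕ (a +ℕ b)))
  ×
  ((a b c : ℕ) →
    P (GS⁺ a b c) 1 ≡
      (frac (2 *ℕ b +ℕ c +ℕ 2) ((b +ℕ c +ℕ 1) *ℕ (b +ℕ c +ℕ 2))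
        + frac (2 *ℕ b +ℕ a +ℕ 2) ((b +ℕ a +ℕ 1) *ℕ (b +ℕ a +ℕ 2)))
        - frac 1 (a +ℕ 2 *ℕ b +ℕ c +ℕ 1))
theorem3 = theorem-GS , theorem-GS⁺
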